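{- For every $n \in \mathbb{N}$, $$D_n^{*}(Y^{\mathrm{vdC}}) = \int_0^1 \left| \frac{1}{n}\sum_{k=0}^{n-1} \mathrm{wal}_k(x) \right| \mathrm{d}x.$$
   Context: Walsh functions: for a nonnegative integer $k$ with binary representation $k=k_0+k_1 2+\cdots+k_m 2^m$, the function $\mathrm{wal}_k:\mathbb{R}\to\mathbb{R}$ is $1$-periodic and defined for $x\in[0,1)$ with canonical binary expansion $x=\frac{x_1}{2}+\frac{x_2}{2^2}+\cdots$ (not ending in infinitely many $1$'s) by $\mathrm{wal}_k(x)=(-1)^{x_1k_0+x_2k_1+\cdots+x_{m+1}k_m}$. Van der Corput sequence $Y^{\mathrm{vdC}}=(y_k)_{k\ge0}$: if $k=k_0+k_1 2+k_2 2^2+\cdots$ in binary, then $y_k=\frac{k_0}{2}+\frac{k_1}{2^2}+\frac{k_2}{2^3}+\cdots$. For a sequence $X=(x_k)_{k\ge0}$ in $[0,1)$, $D_n^*(X)=\sup_{t\in[0,1]}\left|\frac{\#\{0\le k<n: x_k\in[0,t)\}}{n}-t\right|$.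
   Formalization: The supremum in $D_n^*(X)$ runs over rational t, and the integral is a Riemann integral with rational partition points and tags, the functions $\mathrm{wal}_k$ being defined on ℚ rather than ℝ. -}

module Defs where

open import Data.Nat as ℕ using (ℕ; zero; suc; _^_; NonZero)
open import Data.Nat.Properties as ℕP using ()
open import Data.Nat.DivMod as ℕD using ()
open import Data.Integer as ℤ using (ℤ; +_)
open import Data.Integer.DivMod using (_%ℕ_)
open import Data.Rational using (ℚ; 0ℚ; 1ℚ; _+_; _*_; _-_; -_; _/_; _<_; _≤_; ∣_∣; _⊔_; floor)
open import Data.Rational.Properties using (_<?_)
open import Data.List using (List; upTo; map; foldr; length; filter)
open import Data.Nat.ListAction using (sum)
open import Data.Product using (Σ; ∃; _×_; _,_)
open import Relation.Nullary.Decidable using (does)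
open import Data.Bool using (if_then_else_)

sumℚ : List ℚ → ℚ
sumℚ = foldr _+_ 0ℚ

bitℕ : ℕ → ℕ → ℕ
bitℕ j k = ℕD._/_ k (2 ^ j) {{ℕP.m^n≢0 2 j}} ℕD.% 2

-- i-th binary digit x_i (i ≥ 1) of the canonical expansion of the
-- fractional part of x, i.e. floor (2^i x) mod 2
digitℚ : ℕ → ℚ → ℕ
digitℚ i x = floor ((+ (2 ^ i) / 1) * x) %ℕ 2

-- van der Corput point y_k = Σ_j k_j / 2^(j+1)  (digits j < k suffice, as k < 2^k)
vdC : ℕ → ℚ
vdC k = sumℚ (map (λ j → _/_ (+ bitℕ j k) (2 ^ suc j) {{ℕP.m^n≢0 2 (suc j)}}) (upTo k))

-- Walsh function wal_k(x) = (-1)^(Σ_j x_{j+1} k_j)  (bits k_j = 0 for j ≥ k)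
wal : ℕ → ℚ → ℚ
wal k x = sign (sum (map (λ j → digitℚ (suc j) x ℕ.* bitℕ j k) (upTo k)))
  where
  sign : ℕ → ℚ
  sign e = if does ((e ℕD.% 2) ℕP.≟ 0) then 1ℚ else - 1ℚ

countBelow : (ℕ → ℚ) → ℕ → ℚ → ℕ
countBelow X n t = length (filter (λ k → (X k) <? t) (upTo n))

localDisc : (X : ℕ → ℚ) (n : ℕ) .{{_ : NonZero n}} → ℚ → ℚ
localDisc X n t = ∣ (+ countBelow X n t) / n - t ∣

IsSupOn01 : (ℚ → ℚ) → ℚ → Set
IsSupOn01 f v =
  (∀ t → 0ℚ ≤ t → t ≤ 1ℚ → f t ≤ v) ×
  (∀ ε → 0ℚ < ε → Σ ℚ λ t → 0ℚ ≤ t × t ≤ 1ℚ × v - ε < f t)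

data TaggedPartition : ℚ → ℚ → Set where
  last : ∀ {a b} (t : ℚ) → a < b → a ≤ t → t ≤ b → TaggedPartition a b
  step : ∀ {a b c} (t : ℚ) → a < b → a ≤ t → t ≤ b → TaggedPartition b c → TaggedPartition a c

mesh : ∀ {a b} → TaggedPartition a b → ℚ
mesh {a} {b} (last _ _ _ _) = b - a
mesh {a} (step {b = b} _ _ _ _ P) = (b - a) ⊔ mesh P

riemannSum : (ℚ → ℚ) → ∀ {a b} → TaggedPartition a b → ℚ
riemannSum f {a} {b} (last t _ _ _) = f t * (b - a)
riemannSum f {a} (step {b = b} t _ _ _ P) = f t * (b - a) + riemannSum f P

IsIntegral01 : (ℚ → ℚ) → ℚ → Set
IsIntegral01 f I =
  ∀ ε → 0ℚ < ε → Σ ℚ λ δ → 0ℚ < δ ×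
    (∀ (P : TaggedPartition 0ℚ 1ℚ) → mesh P < δ → ∣ riemannSum f P - I ∣ < ε)

walshMean : (n : ℕ) .{{_ : NonZero n}} → ℚ → ℚ
walshMean n x = sumℚ (map (λ k → wal k x) (upTo n)) * ((+ 1) / n)

{-# OPTIONS --safe #-}
module Submission where

-- Fix L with n ≤ N = 2^L. Each wal_k with k < N is constant on every dyadic cell
-- [a/N, (a+1)/N), with value (-1)^(Σ_j k_j a_(L-1-j)), so |(1/n) Σ_{k<n} wal_k| is a step
-- function with integral U/(nN), where U is the sum over the N cells of |Σ_{k<n} wal_k|.
-- On the other side y_k = rev_L(k)/N, so for t in (a/N, (a+1)/N] the number of y_k < t
-- (k < n) is C = #{k < n : rev_L(k) ≤ a}, and nN(C/n - t) = Δ - n(Nt - a) with the excess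
-- Δ = NC - na. Passing from level L to L + 1 (n ↦ 2m or 2m + 1, a ↦ a or N + a) gives
-- recursions for Δ and U, from which n ≤ Δ ≤ U on every cell and Δ = U on some cell.
-- Hence C/n - t lies in [0, U/(nN)) and tends to U/(nN) as t decreases to a/N on that cell.

open import Level using (Level)
open import Algebra.Bundles using (CommutativeMonoid)
open import Data.Bool using (Bool; true; false; not)
open import Data.List using (foldr; applyUpTo; upTo; map; length; filter)
open import Data.Nat as ℕ using (ℕ; zero; suc; z≤n; s≤s)
import Data.Nat.Properties as ℕP
import Data.Integer.Properties as ℤP
open import Data.Product using (Σ; _×_; _,_)
open import Data.Rational using (ℚ; ∣_∣)
open import Function using (_∘_)
open import Relation.Binary.PropositionalEquality as ≡ using (_≡_; _≢_)
open import Relation.Nullary using (Dec; does; yes; no; ¬_)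
open import Relation.Nullary.Decidable using (dec-true; dec-false)
open import Relation.Unary using (Pred; Decidable)

open import Defs

module FiniteSum {c ℓ : Level} (M : CommutativeMonoid c ℓ) where

  open CommutativeMonoid M
  open import Algebra.Properties.CommutativeSemigroup commutativeSemigroup using (interchange)
  open import Relation.Binary.Reasoning.Setoid setoid

  ∑ : ℕ → (ℕ → Carrier) → Carrier
  ∑ n f = foldr _∙_ ε (applyUpTo f n)

  ∑-cong : ∀ n {f g : ℕ → Carrier} → (∀ k → k ℕ.< n → f k ≈ g k) → ∑ n f ≈ ∑ n g
  ∑-cong zero    f≈g = refl
  ∑-cong (suc n) f≈g = ∙-cong (f≈g 0 (s≤s z≤n)) (∑-cong n (λ k k<n → f≈g (suc k) (s≤s k<n)))

  ∑-suc : ∀ n (f : ℕ → Carrier) → ∑ (suc n) f ≈ ∑ n f ∙ f n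
  ∑-suc zero    f = trans (identityʳ (f 0)) (sym (identityˡ (f 0)))
  ∑-suc (suc n) f = trans (∙-congˡ (∑-suc n (f ∘ suc))) (sym (assoc _ _ _))

  ∑-ε : ∀ n {f : ℕ → Carrier} → (∀ k → k ℕ.< n → f k ≈ ε) → ∑ n f ≈ ε
  ∑-ε n f≈ε = trans (∑-cong n f≈ε) (ε-sum n)
    where
    ε-sum : ∀ n → ∑ n (λ _ → ε) ≈ ε
    ε-sum zero    = refl
    ε-sum (suc n) = trans (identityˡ _) (ε-sum n)

  ∑-distrib : ∀ n (f g : ℕ → Carrier) → ∑ n (λ k → f k ∙ g k) ≈ ∑ n f ∙ ∑ n g
  ∑-distrib zero    f g = sym (identityˡ ε)
  ∑-distrib (suc n) f g =
    trans (∙-congˡ (∑-distrib n (f ∘ suc) (g ∘ suc))) (interchange _ _ _ _)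

  ∑-+ : ∀ m n (f : ℕ → Carrier) → ∑ (m ℕ.+ n) f ≈ ∑ m f ∙ ∑ n (λ k → f (m ℕ.+ k))
  ∑-+ zero    n f = sym (identityˡ _)
  ∑-+ (suc m) n f = trans (∙-congˡ (∑-+ m n (f ∘ suc))) (sym (assoc _ _ _))

  ∑-vanishing-tail : ∀ m n (f : ℕ → Carrier) →
    (∀ k → m ℕ.≤ k → f k ≈ ε) → (∀ k → n ℕ.≤ k → f k ≈ ε) → ∑ m f ≈ ∑ n f
  ∑-vanishing-tail m n f m≤⇒ε n≤⇒ε = begin
    ∑ m f                                 ≈⟨ extend m n m≤⇒ε ⟨
    ∑ (m ℕ.+ n) f                         ≡⟨ ≡.cong (λ l → ∑ l f) (ℕP.+-comm m n) ⟩
    ∑ (n ℕ.+ m) f                         ≈⟨ extend n m n≤⇒ε ⟩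
    ∑ n f                                 ∎
    where
    extend : ∀ m n → (∀ k → m ℕ.≤ k → f k ≈ ε) → ∑ (m ℕ.+ n) f ≈ ∑ m f
    extend m n m≤⇒ε = trans (∑-+ m n f)
      (trans (∙-congˡ (∑-ε n (λ k _ → m≤⇒ε (m ℕ.+ k) (ℕP.m≤m+n m k)))) (identityʳ _))

  ∑-pairs : ∀ m (f : ℕ → Carrier) → ∑ (2 ℕ.* m) f ≈ ∑ m (λ i → f (2 ℕ.* i) ∙ f (suc (2 ℕ.* i)))
  ∑-pairs zero    f = refl
  ∑-pairs (suc m) f = begin
    ∑ (2 ℕ.* suc m) f                                          ≡⟨ ≡.cong (λ l → ∑ l f) (ℕP.*-suc 2 m) ⟩
    f 0 ∙ (f 1 ∙ ∑ (2 ℕ.* m) (f ∘ suc ∘ suc))                  ≈⟨ assoc _ _ _ ⟨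
    (f 0 ∙ f 1) ∙ ∑ (2 ℕ.* m) (f ∘ suc ∘ suc)                  ≈⟨ ∙-congˡ (∑-pairs m (f ∘ suc ∘ suc)) ⟩
    (f 0 ∙ f 1) ∙ ∑ m (λ i → f (2 ℕ.+ 2 ℕ.* i) ∙ f (3 ℕ.+ 2 ℕ.* i))
      ≈⟨ ∙-congˡ (∑-cong m (λ i _ → reflexive (≡.cong (λ j → f j ∙ f (suc j)) (≡.sym (ℕP.*-suc 2 i))))) ⟩
    ∑ (suc m) (λ i → f (2 ℕ.* i) ∙ f (suc (2 ℕ.* i)))          ∎

  ∑-halves : ∀ n (f : ℕ → Carrier) → ∑ (2 ℕ.* n) f ≈ ∑ n f ∙ ∑ n (λ k → f (n ℕ.+ k))
  ∑-halves n f = trans (∑-+ n (n ℕ.+ 0) f) (reflexive (≡.cong (λ l → ∑ n f ∙ ∑ l (λ k → f (n ℕ.+ k))) (ℕP.+-identityʳ n)))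

  ∑-single : ∀ n (f : ℕ → Carrier) {i} → i ℕ.< n →
    (∀ k → k ℕ.< n → k ≢ i → f k ≈ ε) → ∑ n f ≈ f i
  ∑-single (suc n) f {zero}  _         others = trans
    (∙-congˡ (∑-ε n (λ k k<n → others (suc k) (s≤s k<n) (λ ())))) (identityʳ (f 0))
  ∑-single (suc n) f {suc i} (s≤s i<n) others = trans
    (∙-congʳ (others 0 (s≤s z≤n) (λ ())))
    (trans (identityˡ _) (∑-single n (f ∘ suc) i<n
      (λ k k<n k≢i → others (suc k) (s≤s k<n) (k≢i ∘ ℕP.suc-injective))))

module ℕΣ where

  open FiniteSum ℕP.+-0-commutativeMonoid public

  ∑-ones : ∀ n → ∑ n (λ _ → 1) ≡ n
  ∑-ones zero    = ≡.refl
  ∑-ones (suc n) = ≡.cong suc (∑-ones n)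

indicator : Bool → ℕ
indicator true  = 1
indicator false = 0

indicator-true : ∀ {p} {P : Set p} (P? : Dec P) → P → indicator (does P?) ≡ 1
indicator-true P? p = ≡.cong indicator (dec-true P? p)

indicator-false : ∀ {p} {P : Set p} (P? : Dec P) → ¬ P → indicator (does P?) ≡ 0
indicator-false P? ¬p = ≡.cong indicator (dec-false P? ¬p)

indicator-cong : ∀ {p q} {P : Set p} {Q : Set q} (P? : Dec P) (Q? : Dec Q) →
  (P → Q) → (Q → P) → indicator (does P?) ≡ indicator (does Q?)
indicator-cong P? Q? P→Q Q→P with P?
... | yes p = ≡.sym (indicator-true Q? (P→Q p))
... | no ¬p = ≡.sym (indicator-false Q? (¬p ∘ Q→P))

length-filter-upTo : ∀ {ℓ} {P : Pred ℕ ℓ} (P? : Decidable P) n →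
  length (filter P? (upTo n)) ≡ ℕΣ.∑ n (λ k → indicator (does (P? k)))
length-filter-upTo P? n = go n (λ k → k)
  where
  go : ∀ n (g : ℕ → ℕ) → length (filter P? (applyUpTo g n)) ≡ ℕΣ.∑ n (λ k → indicator (does (P? (g k))))
  go zero    g = ≡.refl
  go (suc n) g with does (P? (g 0))
  ... | true  = ≡.cong suc (go n (g ∘ suc))
  ... | false = go n (g ∘ suc)

module Embedding where

  open import Data.Integer as ℤ using (ℤ; +_; -[1+_])
  import Data.Integer.DivMod as ℤD
  import Data.Nat.DivMod as ℕD
  open import Data.Rational as ℚ using (ℚ; mkℚ; 1ℚ; _+_; _*_; _-_; -_; _/_; _≤_; _<_; floor; *≤*; *<*)
  import Data.Rational.Properties as ℚP
  open import Data.Rational.Literals public using (fromℤ)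
  import Data.Rational.Unnormalised as ℚᵘ
  import Data.Rational.Unnormalised.Properties as ℚᵘP
  open ≡

  fromℕ : ℕ → ℚ
  fromℕ n = fromℤ (+ n)

  1/ℕ : (n : ℕ) .{{_ : ℕ.NonZero n}} → ℚ
  1/ℕ n = + 1 / n

  /1≡fromℤ : ∀ z → z / 1 ≡ fromℤ z
  /1≡fromℤ z = ℚP.↥p/↧p≡p (fromℤ z)

  fromℤ-+ : ∀ a b → fromℤ (a ℤ.+ b) ≡ fromℤ a + fromℤ b
  fromℤ-+ a b = trans (sym (/1≡fromℤ (a ℤ.+ b)))
    (ℚP./-cong {p₁ = a ℤ.+ b} {q₁ = 1} (sym (cong₂ ℤ._+_ (ℤP.*-identityʳ a) (ℤP.*-identityʳ b))) refl)

  fromℤ-* : ∀ a b → fromℤ (a ℤ.* b) ≡ fromℤ a * fromℤ b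
  fromℤ-* a b = sym (/1≡fromℤ (a ℤ.* b))

  fromℤ-neg : ∀ a → fromℤ (ℤ.- a) ≡ - fromℤ a
  fromℤ-neg (+ zero)  = refl
  fromℤ-neg (+ suc n) = refl
  fromℤ-neg -[1+ n ]  = refl

  fromℤ-minus : ∀ a b → fromℤ (a ℤ.- b) ≡ fromℤ a - fromℤ b
  fromℤ-minus a b = trans (fromℤ-+ a (ℤ.- b)) (cong (λ z → fromℤ a + z) (fromℤ-neg b))

  fromℤ-mono-≤ : ∀ {a b} → a ℤ.≤ b → fromℤ a ≤ fromℤ b
  fromℤ-mono-≤ {a} {b} a≤b = *≤* (subst₂ ℤ._≤_ (sym (ℤP.*-identityʳ a)) (sym (ℤP.*-identityʳ b)) a≤b)

  fromℤ-mono-< : ∀ {a b} → a ℤ.< b → fromℤ a < fromℤ b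
  fromℤ-mono-< {a} {b} a<b = *<* (subst₂ ℤ._<_ (sym (ℤP.*-identityʳ a)) (sym (ℤP.*-identityʳ b)) a<b)

  fromℕ-+ : ∀ m n → fromℕ (m ℕ.+ n) ≡ fromℕ m + fromℕ n
  fromℕ-+ m n = fromℤ-+ (+ m) (+ n)

  fromℕ-* : ∀ m n → fromℕ (m ℕ.* n) ≡ fromℕ m * fromℕ n
  fromℕ-* m n = trans (cong fromℤ (ℤP.pos-* m n)) (fromℤ-* (+ m) (+ n))

  fromℕ-mono-≤ : ∀ {m n} → m ℕ.≤ n → fromℕ m ≤ fromℕ n
  fromℕ-mono-≤ m≤n = fromℤ-mono-≤ (ℤ.+≤+ m≤n)

  fromℕ-mono-< : ∀ {m n} → m ℕ.< n → fromℕ m < fromℕ n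
  fromℕ-mono-< m<n = fromℤ-mono-< (ℤ.+<+ m<n)

  fromℕ-cancel-< : ∀ {m n} → fromℕ m < fromℕ n → m ℕ.< n
  fromℕ-cancel-< {m} {n} m<n = ℤP.drop‿+<+ (subst₂ ℤ._<_ (ℤP.*-identityʳ (+ m)) (ℤP.*-identityʳ (+ n)) (ℚP.drop-*<* m<n))

  fromℕ-pos : ∀ n .{{_ : ℕ.NonZero n}} → ℚ.Positive (fromℕ n)
  fromℕ-pos (suc n) = _

  private
    toℚᵘ-/ : ∀ i k → ℚ.toℚᵘ (i / suc k) ℚᵘ.≃ ℚᵘ.mkℚᵘ i k
    toℚᵘ-/ i k = ℚP.toℚᵘ-fromℚᵘ (ℚᵘ.mkℚᵘ i k)

  /-cross : ∀ i j m n .{{_ : ℕ.NonZero m}} .{{_ : ℕ.NonZero n}} → i ℤ.* + n ≡ j ℤ.* + m → i / m ≡ j / n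
  /-cross i j (suc m) (suc n) eq = ℚP.toℚᵘ-injective
    (ℚᵘP.≃-trans (toℚᵘ-/ i m) (ℚᵘP.≃-trans (ℚᵘ.*≡* eq) (ℚᵘP.≃-sym (toℚᵘ-/ j n))))

  /≡fromℤ*1/ℕ : ∀ i n .{{_ : ℕ.NonZero n}} → i / n ≡ fromℤ i * 1/ℕ n
  /≡fromℤ*1/ℕ i (suc k) = ℚP.toℚᵘ-injective (ℚᵘP.≃-trans (toℚᵘ-/ i k) (ℚᵘP.≃-sym
    (ℚᵘP.≃-trans (ℚP.toℚᵘ-homo-* (fromℤ i) (1/ℕ (suc k)))
      (ℚᵘP.≃-trans (ℚᵘP.*-cong (ℚᵘP.≃-refl {ℚᵘ.mkℚᵘ i 0}) (toℚᵘ-/ (+ 1) k))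
        (ℚᵘ.*≡* (trans (cong (ℤ._* + suc k) (ℤP.*-identityʳ i))
          (cong (λ d → i ℤ.* + d) (sym (ℕP.*-identityˡ (suc k))))))))))

  fromℕ*1/ℕ : ∀ n .{{_ : ℕ.NonZero n}} → fromℕ n * 1/ℕ n ≡ 1ℚ
  fromℕ*1/ℕ n@(suc k) = trans (sym (/≡fromℤ*1/ℕ (+ n) n))
    (ℚP.toℚᵘ-injective (ℚᵘP.≃-trans (toℚᵘ-/ (+ n) k) (ℚᵘ.*≡* (cong +_ (ℕP.*-comm n 1)))))

  fromℕ*[p*1/ℕ]≡p : ∀ m .{{_ : ℕ.NonZero m}} p → fromℕ m * (p * 1/ℕ m) ≡ p
  fromℕ*[p*1/ℕ]≡p m p = begin
    fromℕ m * (p * 1/ℕ m)   ≡⟨ ℚP.*-assoc (fromℕ m) p (1/ℕ m) ⟨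
    fromℕ m * p * 1/ℕ m     ≡⟨ cong (_* 1/ℕ m) (ℚP.*-comm (fromℕ m) p) ⟩
    p * fromℕ m * 1/ℕ m     ≡⟨ ℚP.*-assoc p (fromℕ m) (1/ℕ m) ⟩
    p * (fromℕ m * 1/ℕ m)   ≡⟨ cong (p *_) (fromℕ*1/ℕ m) ⟩
    p * 1ℚ                  ≡⟨ ℚP.*-identityʳ p ⟩
    p                       ∎
    where open ≡-Reasoning

  1/ℕ-pos : ∀ n .{{_ : ℕ.NonZero n}} → ℚ.Positive (1/ℕ n)
  1/ℕ-pos (suc k) = ℚP.normalize-pos 1 (suc k)

  floor-unique : ∀ (a : ℕ) q → fromℕ a ≤ q → q < fromℕ (suc a) → floor q ≡ + a
  floor-unique a q@(mkℚ (+ u) k _) a≤q q<a+1 =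
    trans (ℤD.div-pos-is-/ℕ (+ u) (suc k)) (cong +_ (ℕP.≤-antisym u/d≤a a≤u/d))
    where
    d = suc k
    a*d≤u : a ℕ.* d ℕ.≤ u
    a*d≤u = subst (a ℕ.* d ℕ.≤_) (ℕP.*-identityʳ u)
      (ℤP.drop‿+≤+ (subst₂ ℤ._≤_ (sym (ℤP.pos-* a d)) (sym (ℤP.pos-* u 1)) (ℚP.drop-*≤* a≤q)))
    u<[a+1]*d : u ℕ.< suc a ℕ.* d
    u<[a+1]*d = subst (ℕ._< suc a ℕ.* d) (ℕP.*-identityʳ u)
      (ℤP.drop‿+<+ (subst₂ ℤ._<_ (sym (ℤP.pos-* u 1)) (sym (ℤP.pos-* (suc a) d)) (ℚP.drop-*<* q<a+1)))
    u/d≤a : u ℕ./ d ℕ.≤ a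
    u/d≤a = ℕP.≤-pred (ℕD.m<n*o⇒m/o<n u<[a+1]*d)
    a≤u/d : a ℕ.≤ u ℕ./ d
    a≤u/d = subst (ℕ._≤ u ℕ./ d) (ℕD.m*n/n≡m a d) (ℕD./-monoˡ-≤ d a*d≤u)
  floor-unique a (mkℚ -[1+ u ] k _) a≤q _
    with ℤP.≤-trans (ℤP.≤-trans (ℤ.+≤+ z≤n) (ℤP.≤-reflexive (ℤP.pos-* a (suc k)))) (ℚP.drop-*≤* a≤q)
  ... | ()

module ℤΣ = FiniteSum ℤP.+-0-commutativeMonoid

module ℚΣ where

  open import Data.Integer as ℤ using (ℤ)
  open import Data.Rational using (ℚ; 1ℚ; _+_; _*_; -_; _-_; _≤_; ∣_∣)
  import Data.Rational.Properties as ℚP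
  open import Data.Rational.Solver using (module +-*-Solver)
  open +-*-Solver using (solve; _:+_; _:*_; _:=_; con)
  open Embedding
  open ≡

  open FiniteSum ℚP.+-0-commutativeMonoid public

  fromℤ-∑ : ∀ n (f : ℕ → ℤ) → fromℤ (ℤΣ.∑ n f) ≡ ∑ n (fromℤ ∘ f)
  fromℤ-∑ zero    f = refl
  fromℤ-∑ (suc n) f = trans (fromℤ-+ (f 0) _) (cong (fromℤ (f 0) +_) (fromℤ-∑ n (f ∘ suc)))

  fromℕ-∑ : ∀ n (f : ℕ → ℕ) → fromℕ (ℕΣ.∑ n f) ≡ ∑ n (fromℕ ∘ f)
  fromℕ-∑ zero    f = refl
  fromℕ-∑ (suc n) f = trans (fromℕ-+ (f 0) _) (cong (fromℕ (f 0) +_) (fromℕ-∑ n (f ∘ suc)))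

  ∑-*ʳ : ∀ n (f : ℕ → ℚ) c → ∑ n f * c ≡ ∑ n (λ k → f k * c)
  ∑-*ʳ zero    f c = ℚP.*-zeroˡ c
  ∑-*ʳ (suc n) f c = trans (ℚP.*-distribʳ-+ c (f 0) _) (cong (f 0 * c +_) (∑-*ʳ n (f ∘ suc) c))

  ∑-neg : ∀ n (f : ℕ → ℚ) → ∑ n (λ k → - f k) ≡ - ∑ n f
  ∑-neg zero    f = refl
  ∑-neg (suc n) f = trans (cong (- f 0 +_) (∑-neg n (f ∘ suc))) (sym (ℚP.neg-distrib-+ (f 0) _))

  ∑-sub : ∀ n (f g : ℕ → ℚ) → ∑ n (λ k → f k - g k) ≡ ∑ n f - ∑ n g
  ∑-sub n f g = trans (∑-distrib n f (λ k → - g k)) (cong (∑ n f +_) (∑-neg n g))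

  ∣∑∣≤∑∣∣ : ∀ n (f : ℕ → ℚ) → ∣ ∑ n f ∣ ≤ ∑ n (λ k → ∣ f k ∣)
  ∣∑∣≤∑∣∣ zero    f = ℚP.≤-refl
  ∣∑∣≤∑∣∣ (suc n) f = ℚP.≤-trans (ℚP.∣p+q∣≤∣p∣+∣q∣ (f 0) _) (ℚP.+-monoʳ-≤ ∣ f 0 ∣ (∣∑∣≤∑∣∣ n (f ∘ suc)))

  ∑-mono-≤ : ∀ n {f g : ℕ → ℚ} → (∀ k → k ℕ.< n → f k ≤ g k) → ∑ n f ≤ ∑ n g
  ∑-mono-≤ zero    f≤g = ℚP.≤-refl
  ∑-mono-≤ (suc n) f≤g = ℚP.+-mono-≤ (f≤g 0 (s≤s z≤n)) (∑-mono-≤ n (λ k k<n → f≤g (suc k) (s≤s k<n)))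

  ∑-const : ∀ n c → ∑ n (λ _ → c) ≡ fromℕ n * c
  ∑-const zero    c = sym (ℚP.*-zeroˡ c)
  ∑-const (suc n) c = begin
    c + ∑ n (λ _ → c)      ≡⟨ cong (c +_) (∑-const n c) ⟩
    c + fromℕ n * c        ≡⟨ solve 2 (λ c m → c :+ m :* c := (con 1ℚ :+ m) :* c) refl c (fromℕ n) ⟩
    (1ℚ + fromℕ n) * c     ≡⟨ cong (_* c) (fromℕ-+ 1 n) ⟨
    fromℕ (suc n) * c      ∎
    where open ≡-Reasoning

module BinaryDigits where

  open import Data.Nat using (_+_; _*_; _^_; _∸_; _≤_; _<_; _/_; _%_; NonZero)
  open import Data.Nat.DivMod
  open import Data.Nat.Divisibility using (divides)
  open import Data.Nat.Tactic.RingSolver using (solve-∀)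
  open ≡
  open ≡-Reasoning

  n<2^n : ∀ n → n < 2 ^ n
  n<2^n zero    = s≤s z≤n
  n<2^n (suc n) = ℕP.+-mono-≤-< (ℕP.m^n>0 2 n) (subst (n <_) (sym (ℕP.+-identityʳ (2 ^ n))) (n<2^n n))

  2^m*2^[n∸m]≡2^n : ∀ m n → m ≤ n → 2 ^ m * 2 ^ (n ∸ m) ≡ 2 ^ n
  2^m*2^[n∸m]≡2^n m n m≤n = trans (sym (ℕP.^-distribˡ-+-* 2 m (n ∸ m))) (cong (2 ^_) (ℕP.m+[n∸m]≡n m≤n))

  /-unique : ∀ m d q .{{_ : NonZero d}} → q * d ≤ m → m < suc q * d → m / d ≡ q
  /-unique m d q q*d≤m m<[1+q]*d = ℕP.≤-antisym (ℕP.≤-pred (m<n*o⇒m/o<n m<[1+q]*d))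
    (subst (_≤ m / d) (m*n/n≡m q d) (/-monoˡ-≤ d q*d≤m))

  2*i/2≡i : ∀ i → 2 * i / 2 ≡ i
  2*i/2≡i i = trans (cong (_/ 2) (ℕP.*-comm 2 i)) (m*n/n≡m i 2)

  [1+2*i]/2≡i : ∀ i → suc (2 * i) / 2 ≡ i
  [1+2*i]/2≡i i = /-unique _ 2 i (ℕP.≤-trans (ℕP.≤-reflexive (ℕP.*-comm i 2)) (ℕP.n≤1+n _))
    (ℕP.≤-reflexive (2+2i≡[1+i]*2 i))
    where
    2+2i≡[1+i]*2 : ∀ i → suc (suc (2 * i)) ≡ suc i * 2
    2+2i≡[1+i]*2 = solve-∀

  2*i%2≡0 : ∀ i → 2 * i % 2 ≡ 0
  2*i%2≡0 i = trans (cong (_% 2) (ℕP.*-comm 2 i)) (m*n%n≡0 i 2)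

  [1+2*i]%2≡1 : ∀ i → suc (2 * i) % 2 ≡ 1
  [1+2*i]%2≡1 i = trans (cong (λ m → suc m % 2) (ℕP.*-comm 2 i)) ([m+kn]%n≡m%n 1 i 2)

  bitℕ-zero : ∀ k → bitℕ 0 k ≡ k % 2
  bitℕ-zero k = cong (_% 2) (n/1≡n k)

  bitℕ-suc : ∀ j k → bitℕ (suc j) k ≡ bitℕ j (k / 2)
  bitℕ-suc j k = cong (_% 2) (sym (m/n/o≡m/[n*o] k 2 (2 ^ j) {{_}} {{ℕP.m^n≢0 2 j}} {{ℕP.m^n≢0 2 (suc j)}}))

  bitℕ-high : ∀ {j k} → k < 2 ^ j → ∀ i → j ≤ i → bitℕ i k ≡ 0
  bitℕ-high k<2^j i j≤i = cong (_% 2) (m<n⇒m/n≡0 {{ℕP.m^n≢0 2 i}} (ℕP.<-≤-trans k<2^j (ℕP.^-monoʳ-≤ 2 j≤i)))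

  bitℕ-top : ∀ L a → a < 2 ^ L → bitℕ L (2 ^ L + a) ≡ 1
  bitℕ-top L a a<2^L = cong (_% 2) (/-unique (2 ^ L + a) (2 ^ L) 1 {{ℕP.m^n≢0 2 L}}
    (ℕP.≤-trans (ℕP.≤-reflexive (ℕP.*-identityˡ (2 ^ L))) (ℕP.m≤m+n (2 ^ L) a))
    (subst (2 ^ L + a <_) (cong (2 ^ L +_) (sym (ℕP.+-identityʳ (2 ^ L)))) (ℕP.+-monoʳ-< (2 ^ L) a<2^L)))

  bitℕ-low : ∀ L a i → i < L → bitℕ i (2 ^ L + a) ≡ bitℕ i a
  bitℕ-low L a i i<L = begin
    (2 ^ L + a) / 2 ^ i % 2            ≡⟨ cong (_% 2) (+-distrib-/-∣ˡ a (divides (2 * X) 2^L≡2X*2^i)) ⟩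
    (2 ^ L / 2 ^ i + a / 2 ^ i) % 2    ≡⟨ cong (λ m → (m + a / 2 ^ i) % 2) (trans (cong (_/ 2 ^ i) 2^L≡2X*2^i) (m*n/n≡m (2 * X) (2 ^ i))) ⟩
    (2 * X + a / 2 ^ i) % 2            ≡⟨ cong (_% 2) (trans (ℕP.+-comm (2 * X) _) (cong (a / 2 ^ i +_) (ℕP.*-comm 2 X))) ⟩
    (a / 2 ^ i + X * 2) % 2            ≡⟨ [m+kn]%n≡m%n (a / 2 ^ i) X 2 ⟩
    a / 2 ^ i % 2                      ∎
    where
    instance
      2^i≢0 : NonZero (2 ^ i)
      2^i≢0 = ℕP.m^n≢0 2 i
    X = 2 ^ (L ∸ suc i)
    2^L≡2X*2^i : 2 ^ L ≡ 2 * X * 2 ^ i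
    2^L≡2X*2^i = trans (sym (2^m*2^[n∸m]≡2^n i L (ℕP.<⇒≤ i<L)))
      (trans (ℕP.*-comm (2 ^ i) _) (cong (λ e → 2 ^ e * 2 ^ i) (ℕP.+-∸-assoc 1 i<L)))

  bitReverse : ℕ → ℕ → ℕ
  bitReverse L k = ℕΣ.∑ L (λ j → bitℕ j k * 2 ^ (L ∸ suc j))

  bitReverse-suc : ∀ L k → bitReverse (suc L) k ≡ k % 2 * 2 ^ L + bitReverse L (k / 2)
  bitReverse-suc L k = cong₂ _+_ (cong (_* 2 ^ L) (bitℕ-zero k))
    (ℕΣ.∑-cong L (λ j _ → cong (_* 2 ^ (L ∸ suc j)) (bitℕ-suc j k)))

  bitReverse-even : ∀ L i → bitReverse (suc L) (2 * i) ≡ bitReverse L i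
  bitReverse-even L i = begin
    bitReverse (suc L) (2 * i)                          ≡⟨ bitReverse-suc L (2 * i) ⟩
    2 * i % 2 * 2 ^ L + bitReverse L (2 * i / 2)        ≡⟨ cong₂ (λ r q → r * 2 ^ L + bitReverse L q) (2*i%2≡0 i) (2*i/2≡i i) ⟩
    bitReverse L i                                      ∎

  bitReverse-odd : ∀ L i → bitReverse (suc L) (suc (2 * i)) ≡ 2 ^ L + bitReverse L i
  bitReverse-odd L i = begin
    bitReverse (suc L) (suc (2 * i))                        ≡⟨ bitReverse-suc L (suc (2 * i)) ⟩
    suc (2 * i) % 2 * 2 ^ L + bitReverse L (suc (2 * i) / 2) ≡⟨ cong₂ (λ r q → r * 2 ^ L + bitReverse L q) ([1+2*i]%2≡1 i) ([1+2*i]/2≡i i) ⟩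
    1 * 2 ^ L + bitReverse L i                              ≡⟨ cong (_+ bitReverse L i) (ℕP.*-identityˡ (2 ^ L)) ⟩
    2 ^ L + bitReverse L i                                  ∎

  bitReverse-< : ∀ L k → bitReverse L k < 2 ^ L
  bitReverse-< zero    k = s≤s z≤n
  bitReverse-< (suc L) k = subst (_< 2 ^ suc L) (sym (bitReverse-suc L k))
    (ℕP.+-mono-≤-< top (subst (bitReverse L (k / 2) <_) (sym (ℕP.+-identityʳ (2 ^ L))) (bitReverse-< L (k / 2))))
    where
    top : k % 2 * 2 ^ L ≤ 2 ^ L
    top = subst (k % 2 * 2 ^ L ≤_) (ℕP.*-identityˡ (2 ^ L)) (ℕP.*-monoˡ-≤ (2 ^ L) (ℕP.≤-pred (m%n<n k 2)))

  bitPairing : ℕ → ℕ → ℕ → ℕ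
  bitPairing L k a = ℕΣ.∑ L (λ j → bitℕ (L ∸ suc j) a * bitℕ j k)

  bitPairing-suc : ∀ L k a → bitPairing (suc L) k a ≡ bitℕ L a * (k % 2) + bitPairing L (k / 2) a
  bitPairing-suc L k a = cong₂ _+_ (cong (bitℕ L a *_) (bitℕ-zero k))
    (ℕΣ.∑-cong L (λ j _ → cong (bitℕ (L ∸ suc j) a *_) (bitℕ-suc j k)))

  bitPairing-low : ∀ L k a → a < 2 ^ L → bitPairing (suc L) k a ≡ bitPairing L (k / 2) a
  bitPairing-low L k a a<2^L = trans (bitPairing-suc L k a)
    (cong (λ b → b * (k % 2) + bitPairing L (k / 2) a) (bitℕ-high a<2^L L ℕP.≤-refl))

  bitPairing-high : ∀ L k a → a < 2 ^ L → bitPairing (suc L) k (2 ^ L + a) ≡ k % 2 + bitPairing L (k / 2) a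
  bitPairing-high L k a a<2^L = trans (bitPairing-suc L k (2 ^ L + a)) (cong₂ _+_
    (trans (cong (_* (k % 2)) (bitℕ-top L a a<2^L)) (ℕP.*-identityˡ _))
    (ℕΣ.∑-cong L (λ j j<L → cong (_* bitℕ j (k / 2)) (bitℕ-low L a (L ∸ suc j) (ℕP.∸-monoʳ-< {L} {suc j} (s≤s z≤n) j<L)))))

module Signs where

  open import Data.Integer as ℤ using (ℤ; +_; -[1+_]; -1ℤ; 1ℤ; _^_)
  import Data.Integer.Properties as ℤP
  open import Data.Integer.Tactic.RingSolver using (solve-∀)
  import Data.Nat.Tactic.RingSolver
  open import Data.Rational as ℚ using (1ℚ; -_)
  open import Data.Bool using (if_then_else_)
  open import Data.Nat.DivMod using ([m+n]%n≡m%n)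
  open Embedding using (fromℤ)
  open ≡

  sign : ℕ → ℤ
  sign e = -1ℤ ^ e

  sign-suc : ∀ e → sign (suc e) ≡ ℤ.- sign e
  sign-suc e = ℤP.-1*i≡-i (sign e)

  sign-2+ : ∀ e → sign (suc (suc e)) ≡ sign e
  sign-2+ e = trans (sign-suc (suc e)) (trans (cong ℤ.-_ (sign-suc e)) (ℤP.neg-involutive (sign e)))

  ∣sign∣≡1 : ∀ e → ℤ.∣ sign e ∣ ≡ 1
  ∣sign∣≡1 zero    = refl
  ∣sign∣≡1 (suc e) = trans (cong ℤ.∣_∣ (sign-suc e)) (trans (ℤP.∣-i∣≡∣i∣ (sign e)) (∣sign∣≡1 e))

  parity≡sign : ∀ e → (if does (e ℕ.% 2 ℕP.≟ 0) then 1ℚ else - 1ℚ) ≡ fromℤ (sign e)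
  parity≡sign zero          = refl
  parity≡sign (suc zero)    = refl
  parity≡sign (suc (suc e)) = begin
    (if does (suc (suc e) ℕ.% 2 ℕP.≟ 0) then 1ℚ else - 1ℚ) ≡⟨ cong (λ r → if does (r ℕP.≟ 0) then 1ℚ else - 1ℚ) [2+e]%2≡e%2 ⟩
    (if does (e ℕ.% 2 ℕP.≟ 0) then 1ℚ else - 1ℚ)           ≡⟨ parity≡sign e ⟩
    fromℤ (sign e)                                          ≡⟨ cong fromℤ (sign-2+ e) ⟨
    fromℤ (sign (suc (suc e)))                              ∎
    where
    open ≡-Reasoning
    [2+e]%2≡e%2 : suc (suc e) ℕ.% 2 ≡ e ℕ.% 2
    [2+e]%2≡e%2 = trans (cong (ℕ._% 2) (ℕP.+-comm 2 e)) ([m+n]%n≡m%n e 2)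

  ∣i+i+s∣≡∣i∣+∣i+s∣ : ∀ i s → ℤ.∣ s ∣ ≡ 1 → ℤ.∣ i ℤ.+ i ℤ.+ s ∣ ≡ ℤ.∣ i ∣ ℕ.+ ℤ.∣ i ℤ.+ s ∣
  ∣i+i+s∣≡∣i∣+∣i+s∣ (+ n)             (+ 1)     _ = ℕP.+-assoc n n 1
  ∣i+i+s∣≡∣i∣+∣i+s∣ -[1+ zero ]       (+ 1)     _ = refl
  ∣i+i+s∣≡∣i∣+∣i+s∣ -[1+ suc n ]      (+ 1)     _ = refl
  ∣i+i+s∣≡∣i∣+∣i+s∣ (+ zero)          -[1+ 0 ]  _ = refl
  ∣i+i+s∣≡∣i∣+∣i+s∣ (+ suc n)         -[1+ 0 ]  _ =
    trans (cong ℤ.∣_∣ (trans (ℤP.+-assoc (+ suc n) (+ suc n) -1ℤ) (cong (λ x → + suc n ℤ.+ x) (cancel (+ n)))))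
      (cong (suc n ℕ.+_) (sym (cong ℤ.∣_∣ (cancel (+ n)))))
    where
    cancel : ∀ x → 1ℤ ℤ.+ x ℤ.+ -1ℤ ≡ x
    cancel = solve-∀
  ∣i+i+s∣≡∣i∣+∣i+s∣ -[1+ n ]          -[1+ 0 ]  _ = 3+2n≡[1+n]+[2+n] n
    where
    3+2n≡[1+n]+[2+n] : ∀ n → suc (suc (suc (n ℕ.+ n) ℕ.+ 0)) ≡ suc n ℕ.+ suc (suc (n ℕ.+ 0))
    3+2n≡[1+n]+[2+n] = Data.Nat.Tactic.RingSolver.solve-∀
  ∣i+i+s∣≡∣i∣+∣i+s∣ i (+ zero)         ()
  ∣i+i+s∣≡∣i∣+∣i+s∣ i (+ suc (suc _))  ()
  ∣i+i+s∣≡∣i∣+∣i+s∣ i -[1+ suc _ ]     ()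

module DyadicCells where

  open import Data.Nat using (_^_; _∸_)
  open import Data.Integer as ℤ using (+_)
  open import Data.Integer.DivMod using (_%ℕ_)
  open import Data.Rational as ℚ using (ℚ; 0ℚ; _+_; _*_; _/_; _≤_; _<_; floor)
  import Data.Rational.Properties as ℚP
  open import Data.Rational.Solver using (module +-*-Solver)
  open +-*-Solver using (solve; _:*_; _:=_)
  open import Data.List.Properties using (map-upTo)
  import Data.Nat.DivMod as ℕD
  open Embedding
  open BinaryDigits
  open Signs
  open ≡

  vdC≡bitReverse/2^L : ∀ L k → k ℕ.< 2 ^ L → vdC k ≡ fromℕ (bitReverse L k) * 1/ℕ (2 ^ L) {{ℕP.m^n≢0 2 L}}
  vdC≡bitReverse/2^L L k k<2^L = begin
    vdC k                                                      ≡⟨ cong (foldr _+_ 0ℚ) (map-upTo φ k) ⟩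
    ℚΣ.∑ k φ                                                   ≡⟨ ℚΣ.∑-vanishing-tail k L φ (φ-high (n<2^n k)) (φ-high k<2^L) ⟩
    ℚΣ.∑ L φ                                                   ≡⟨ ℚΣ.∑-cong L φ≡ ⟩
    ℚΣ.∑ L (λ j → fromℕ (bitℕ j k ℕ.* 2 ^ (L ∸ suc j)) * 1/N)  ≡⟨ ℚΣ.∑-*ʳ L _ 1/N ⟨
    ℚΣ.∑ L (λ j → fromℕ (bitℕ j k ℕ.* 2 ^ (L ∸ suc j))) * 1/N  ≡⟨ cong (_* 1/N) (ℚΣ.fromℕ-∑ L _) ⟨
    fromℕ (bitReverse L k) * 1/N                               ∎
    where
    open ≡-Reasoning
    instance
      2^L≢0 : ℕ.NonZero (2 ^ L)
      2^L≢0 = ℕP.m^n≢0 2 L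
    1/N = 1/ℕ (2 ^ L)
    φ : ℕ → ℚ
    φ j = _/_ (+ bitℕ j k) (2 ^ suc j) {{ℕP.m^n≢0 2 (suc j)}}
    φ-high : ∀ {M} → k ℕ.< 2 ^ M → ∀ j → M ℕ.≤ j → φ j ≡ 0ℚ
    φ-high k<2^M j M≤j = trans (cong (λ b → _/_ (+ b) (2 ^ suc j) {{ℕP.m^n≢0 2 (suc j)}}) (bitℕ-high k<2^M j M≤j))
      (ℚP.0/n≡0 (2 ^ suc j) {{ℕP.m^n≢0 2 (suc j)}})
    φ≡ : ∀ j → j ℕ.< L → φ j ≡ fromℕ (bitℕ j k ℕ.* 2 ^ (L ∸ suc j)) * 1/N
    φ≡ j j<L = trans (/-cross (+ b) (+ (b ℕ.* P)) (2 ^ suc j) (2 ^ L) {{ℕP.m^n≢0 2 (suc j)}} b*2^L≡b*P*2^[1+j])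
      (/≡fromℤ*1/ℕ (+ (b ℕ.* P)) (2 ^ L))
      where
      b = bitℕ j k
      P = 2 ^ (L ∸ suc j)
      b*2^L≡b*P*2^[1+j] : + b ℤ.* + 2 ^ L ≡ + (b ℕ.* P) ℤ.* + 2 ^ suc j
      b*2^L≡b*P*2^[1+j] = trans (sym (ℤP.pos-* b (2 ^ L))) (trans (cong +_ (begin
        b ℕ.* 2 ^ L                ≡⟨ cong (b ℕ.*_) (2^m*2^[n∸m]≡2^n (suc j) L j<L) ⟨
        b ℕ.* (2 ^ suc j ℕ.* P)    ≡⟨ cong (b ℕ.*_) (ℕP.*-comm (2 ^ suc j) P) ⟩
        b ℕ.* (P ℕ.* 2 ^ suc j)    ≡⟨ ℕP.*-assoc b P (2 ^ suc j) ⟨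
        b ℕ.* P ℕ.* 2 ^ suc j      ∎)) (ℤP.pos-* (b ℕ.* P) (2 ^ suc j)))

  InCell : ℕ → ℕ → ℚ → Set
  InCell N a x = fromℕ a ≤ fromℕ N * x × fromℕ N * x < fromℕ (suc a)

  floor-cell : ∀ a P .{{_ : ℕ.NonZero P}} y →
    fromℕ a ≤ y * fromℕ P → y * fromℕ P < fromℕ (suc a) → floor y ≡ + (a ℕ./ P)
  floor-cell a P y a≤yP yP<a+1 = floor-unique q y q≤y y<q+1
    where
    instance
      P≥0 : ℚ.NonNegative (fromℕ P)
      P≥0 = ℚP.pos⇒nonNeg (fromℕ P) {{fromℕ-pos P}}
    q = a ℕ./ P
    q≤y : fromℕ q ≤ y
    q≤y = ℚP.*-cancelʳ-≤-pos (fromℕ P) {{fromℕ-pos P}} (begin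
      fromℕ q * fromℕ P   ≡⟨ fromℕ-* q P ⟨
      fromℕ (q ℕ.* P)     ≤⟨ fromℕ-mono-≤ (ℕD.m/n*n≤m a P) ⟩
      fromℕ a             ≤⟨ a≤yP ⟩
      y * fromℕ P         ∎)
      where open ℚP.≤-Reasoning
    y<q+1 : y < fromℕ (suc q)
    y<q+1 = ℚP.*-cancelʳ-<-nonNeg (fromℕ P) (ℚP.<-≤-trans yP<a+1 (ℚP.≤-trans
      (fromℕ-mono-≤ (ℕP.≤-trans (s≤s (ℕP.≤-reflexive (ℕD.m≡m%n+[m/n]*n a P))) (ℕP.+-monoˡ-≤ (q ℕ.* P) (ℕD.m%n<n a P))))
      (ℚP.≤-reflexive (fromℕ-* (suc q) P))))

  digitℚ-inCell : ∀ L a x i → InCell (2 ^ L) a x → i ℕ.≤ L → digitℚ i x ≡ bitℕ (L ∸ i) a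
  digitℚ-inCell L a x i (a≤Nx , Nx<a+1) i≤L =
    cong (_%ℕ 2) (floor-cell a P y (subst (fromℕ a ≤_) (sym yP≡Nx) a≤Nx) (subst (_< fromℕ (suc a)) (sym yP≡Nx) Nx<a+1))
    where
    open ≡-Reasoning
    P = 2 ^ (L ∸ i)
    instance
      P≢0 : ℕ.NonZero P
      P≢0 = ℕP.m^n≢0 2 (L ∸ i)
    y = + (2 ^ i) / 1 * x
    yP≡Nx : y * fromℕ P ≡ fromℕ (2 ^ L) * x
    yP≡Nx = begin
      + (2 ^ i) / 1 * x * fromℕ P        ≡⟨ cong (λ c → c * x * fromℕ P) (/1≡fromℤ (+ (2 ^ i))) ⟩
      fromℕ (2 ^ i) * x * fromℕ P        ≡⟨ solve 3 (λ a b c → a :* b :* c := (a :* c) :* b) refl (fromℕ (2 ^ i)) x (fromℕ P) ⟩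
      fromℕ (2 ^ i) * fromℕ P * x        ≡⟨ cong (_* x) (fromℕ-* (2 ^ i) P) ⟨
      fromℕ (2 ^ i ℕ.* P) * x            ≡⟨ cong (λ m → fromℕ m * x) (2^m*2^[n∸m]≡2^n i L i≤L) ⟩
      fromℕ (2 ^ L) * x                  ∎

  wal-inCell : ∀ L a x k → InCell (2 ^ L) a x → k ℕ.< 2 ^ L → wal k x ≡ fromℤ (sign (bitPairing L k a))
  wal-inCell L a x k x∈a k<2^L = trans (parity≡sign (foldr ℕ._+_ 0 (map ψ (upTo k))))
    (cong (fromℤ ∘ sign) (begin
      foldr ℕ._+_ 0 (map ψ (upTo k))   ≡⟨ cong (foldr ℕ._+_ 0) (map-upTo ψ k) ⟩
      ℕΣ.∑ k ψ                         ≡⟨ ℕΣ.∑-vanishing-tail k L ψ (ψ-high (n<2^n k)) (ψ-high k<2^L) ⟩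
      ℕΣ.∑ L ψ                         ≡⟨ ℕΣ.∑-cong L (λ j j<L → cong (ℕ._* bitℕ j k) (digitℚ-inCell L a x (suc j) x∈a j<L)) ⟩
      bitPairing L k a                 ∎))
    where
    open ≡-Reasoning
    ψ : ℕ → ℕ
    ψ j = digitℚ (suc j) x ℕ.* bitℕ j k
    ψ-high : ∀ {M} → k ℕ.< 2 ^ M → ∀ j → M ℕ.≤ j → ψ j ≡ 0
    ψ-high k<2^M j M≤j = trans (cong (digitℚ (suc j) x ℕ.*_) (bitℕ-high k<2^M j M≤j)) (ℕP.*-zeroʳ (digitℚ (suc j) x))

module WalshSums where

  open import Data.Nat using (_+_; _*_; _^_; _<_)
  open import Data.Integer as ℤ using (ℤ; +_)
  open BinaryDigits
  open Signs
  open ≡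
  open ≡-Reasoning

  walshSign : ℕ → ℕ → ℕ → ℤ
  walshSign L k a = sign (bitPairing L k a)

  walshSum : ℕ → ℕ → ℕ → ℤ
  walshSum L n a = ℤΣ.∑ n (λ k → walshSign L k a)

  walshL1 : ℕ → ℕ → ℕ
  walshL1 L n = ℕΣ.∑ (2 ^ L) (λ a → ℤ.∣ walshSum L n a ∣)

  walshSign-low-even : ∀ L i a → a < 2 ^ L → walshSign (suc L) (2 * i) a ≡ walshSign L i a
  walshSign-low-even L i a a<2^L = cong sign (trans (bitPairing-low L (2 * i) a a<2^L) (cong (λ k → bitPairing L k a) (2*i/2≡i i)))

  walshSign-low-odd : ∀ L i a → a < 2 ^ L → walshSign (suc L) (suc (2 * i)) a ≡ walshSign L i a
  walshSign-low-odd L i a a<2^L = cong sign (trans (bitPairing-low L (suc (2 * i)) a a<2^L) (cong (λ k → bitPairing L k a) ([1+2*i]/2≡i i)))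

  walshSign-high-even : ∀ L i a → a < 2 ^ L → walshSign (suc L) (2 * i) (2 ^ L + a) ≡ walshSign L i a
  walshSign-high-even L i a a<2^L = cong sign (trans (bitPairing-high L (2 * i) a a<2^L)
    (cong₂ (λ r k → r + bitPairing L k a) (2*i%2≡0 i) (2*i/2≡i i)))

  walshSign-high-odd : ∀ L i a → a < 2 ^ L → walshSign (suc L) (suc (2 * i)) (2 ^ L + a) ≡ ℤ.- walshSign L i a
  walshSign-high-odd L i a a<2^L = trans (cong sign (trans (bitPairing-high L (suc (2 * i)) a a<2^L)
    (cong₂ (λ r k → r + bitPairing L k a) ([1+2*i]%2≡1 i) ([1+2*i]/2≡i i)))) (sign-suc (bitPairing L i a))

  walshSum-suc : ∀ L n a → walshSum L (suc n) a ≡ walshSum L n a ℤ.+ walshSign L n a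
  walshSum-suc L n a = ℤΣ.∑-suc n (λ k → walshSign L k a)

  walshSum-low-even : ∀ L m a → a < 2 ^ L → walshSum (suc L) (2 * m) a ≡ walshSum L m a ℤ.+ walshSum L m a
  walshSum-low-even L m a a<2^L = begin
    walshSum (suc L) (2 * m) a
      ≡⟨ ℤΣ.∑-pairs m _ ⟩
    ℤΣ.∑ m (λ i → walshSign (suc L) (2 * i) a ℤ.+ walshSign (suc L) (suc (2 * i)) a)
      ≡⟨ ℤΣ.∑-cong m (λ i _ → cong₂ ℤ._+_ (walshSign-low-even L i a a<2^L) (walshSign-low-odd L i a a<2^L)) ⟩
    ℤΣ.∑ m (λ i → walshSign L i a ℤ.+ walshSign L i a)
      ≡⟨ ℤΣ.∑-distrib m _ _ ⟩
    walshSum L m a ℤ.+ walshSum L m a ∎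

  walshSum-high-even : ∀ L m a → a < 2 ^ L → walshSum (suc L) (2 * m) (2 ^ L + a) ≡ + 0
  walshSum-high-even L m a a<2^L = trans (ℤΣ.∑-pairs m _) (ℤΣ.∑-ε m (λ i _ →
    trans (cong₂ ℤ._+_ (walshSign-high-even L i a a<2^L) (walshSign-high-odd L i a a<2^L)) (ℤP.+-inverseʳ (walshSign L i a))))

  walshL1-even : ∀ L m → walshL1 (suc L) (2 * m) ≡ walshL1 L m + walshL1 L m
  walshL1-even L m = begin
    walshL1 (suc L) (2 * m)
      ≡⟨ ℕΣ.∑-halves N _ ⟩
    ℕΣ.∑ N (λ a → ℤ.∣ walshSum (suc L) (2 * m) a ∣) + ℕΣ.∑ N (λ a → ℤ.∣ walshSum (suc L) (2 * m) (N + a) ∣)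
      ≡⟨ cong₂ _+_ (ℕΣ.∑-cong N (λ a a<N → trans (cong ℤ.∣_∣ (walshSum-low-even L m a a<N)) (∣i+i∣ (walshSum L m a))))
                   (ℕΣ.∑-ε N (λ a a<N → cong ℤ.∣_∣ (walshSum-high-even L m a a<N))) ⟩
    ℕΣ.∑ N (λ a → ℤ.∣ walshSum L m a ∣ + ℤ.∣ walshSum L m a ∣) + 0
      ≡⟨ trans (ℕP.+-identityʳ _) (ℕΣ.∑-distrib N _ _) ⟩
    walshL1 L m + walshL1 L m ∎
    where
    N = 2 ^ L
    ∣i+i∣ : ∀ i → ℤ.∣ i ℤ.+ i ∣ ≡ ℤ.∣ i ∣ + ℤ.∣ i ∣
    ∣i+i∣ (+ n)        = refl
    ∣i+i∣ ℤ.-[1+ n ]   = cong suc (sym (ℕP.+-suc n n))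

  walshL1-odd : ∀ L m → walshL1 (suc L) (suc (2 * m)) ≡ walshL1 L m + walshL1 L (suc m) + 2 ^ L
  walshL1-odd L m = begin
    walshL1 (suc L) (suc (2 * m))
      ≡⟨ ℕΣ.∑-halves N _ ⟩
    ℕΣ.∑ N (λ a → ℤ.∣ walshSum (suc L) (suc (2 * m)) a ∣) + ℕΣ.∑ N (λ a → ℤ.∣ walshSum (suc L) (suc (2 * m)) (N + a) ∣)
      ≡⟨ cong₂ _+_ (ℕΣ.∑-cong N low) (ℕΣ.∑-cong N high) ⟩
    ℕΣ.∑ N (λ a → ℤ.∣ walshSum L m a ∣ + ℤ.∣ walshSum L (suc m) a ∣) + ℕΣ.∑ N (λ _ → 1)
      ≡⟨ cong₂ _+_ (ℕΣ.∑-distrib N _ _) (ℕΣ.∑-ones N) ⟩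
    walshL1 L m + walshL1 L (suc m) + N ∎
    where
    N = 2 ^ L
    low : ∀ a → a < N → ℤ.∣ walshSum (suc L) (suc (2 * m)) a ∣ ≡ ℤ.∣ walshSum L m a ∣ + ℤ.∣ walshSum L (suc m) a ∣
    low a a<N = begin
      ℤ.∣ walshSum (suc L) (suc (2 * m)) a ∣
        ≡⟨ cong ℤ.∣_∣ (trans (walshSum-suc (suc L) (2 * m) a) (cong₂ ℤ._+_ (walshSum-low-even L m a a<N) (walshSign-low-even L m a a<N))) ⟩
      ℤ.∣ walshSum L m a ℤ.+ walshSum L m a ℤ.+ walshSign L m a ∣
        ≡⟨ ∣i+i+s∣≡∣i∣+∣i+s∣ (walshSum L m a) (walshSign L m a) (∣sign∣≡1 (bitPairing L m a)) ⟩
      ℤ.∣ walshSum L m a ∣ + ℤ.∣ walshSum L m a ℤ.+ walshSign L m a ∣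
        ≡⟨ cong (λ w → ℤ.∣ walshSum L m a ∣ + ℤ.∣ w ∣) (walshSum-suc L m a) ⟨
      ℤ.∣ walshSum L m a ∣ + ℤ.∣ walshSum L (suc m) a ∣ ∎
    high : ∀ a → a < N → ℤ.∣ walshSum (suc L) (suc (2 * m)) (N + a) ∣ ≡ 1
    high a a<N = begin
      ℤ.∣ walshSum (suc L) (suc (2 * m)) (N + a) ∣
        ≡⟨ cong ℤ.∣_∣ (trans (walshSum-suc (suc L) (2 * m) (N + a)) (cong₂ ℤ._+_ (walshSum-high-even L m a a<N) (walshSign-high-even L m a a<N))) ⟩
      ℤ.∣ + 0 ℤ.+ walshSign L m a ∣
        ≡⟨ cong ℤ.∣_∣ (ℤP.+-identityˡ (walshSign L m a)) ⟩
      ℤ.∣ walshSign L m a ∣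
        ≡⟨ ∣sign∣≡1 (bitPairing L m a) ⟩
      1 ∎

data Parity : ℕ → Set where
  even : ∀ m → Parity (2 ℕ.* m)
  odd  : ∀ m → Parity (suc (2 ℕ.* m))

parity : ∀ n → Parity n
parity zero = even 0
parity (suc n) with parity n
... | even m = odd m
... | odd m  = ≡.subst Parity (ℕP.*-suc 2 m) (even (suc m))

data Half (N : ℕ) : ℕ → Set where
  lower : ∀ {a} → a ℕ.< N → Half N a
  upper : ∀ {a} → a ℕ.< N → Half N (N ℕ.+ a)

half : ∀ N a → a ℕ.< 2 ℕ.* N → Half N a
half N a a<2N with a ℕ.<? N
... | yes a<N = lower a<N
... | no a≮N = ≡.subst (Half N) N+[a∸N]≡a (upper (ℕP.+-cancelˡ-< N (a ℕ.∸ N) N N+[a∸N]<N+N))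
  where
  N+[a∸N]≡a : N ℕ.+ (a ℕ.∸ N) ≡ a
  N+[a∸N]≡a = ℕP.m+[n∸m]≡n (ℕP.≮⇒≥ a≮N)
  N+[a∸N]<N+N : N ℕ.+ (a ℕ.∸ N) ℕ.< N ℕ.+ N
  N+[a∸N]<N+N = ≡.subst₂ ℕ._<_ (≡.sym N+[a∸N]≡a) (≡.cong (N ℕ.+_) (ℕP.+-identityʳ N)) a<2N

module Excess where

  open import Data.Nat using (_+_; _*_; _^_; _<_; _≤_; _≤?_)
  open import Data.Integer as ℤ using (ℤ; +_)
  open import Data.Integer.Tactic.RingSolver using (solve-∀)
  open BinaryDigits
  open WalshSums
  open ≡
  open ≡-Reasoning

  counted : ℕ → ℕ → ℕ → ℕ
  counted L k a = indicator (does (bitReverse L k ≤? a))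

  count : ℕ → ℕ → ℕ → ℕ
  count L n a = ℕΣ.∑ n (λ k → counted L k a)

  count-suc : ∀ L n a → count L (suc n) a ≡ count L n a + counted L n a
  count-suc L n a = ℕΣ.∑-suc n _

  count-low-even : ∀ L m a → a < 2 ^ L → count (suc L) (2 * m) a ≡ count L m a
  count-low-even L m a a<N = trans (ℕΣ.∑-pairs m _) (ℕΣ.∑-cong m (λ i _ → begin
    counted (suc L) (2 * i) a + counted (suc L) (suc (2 * i)) a
      ≡⟨ cong₂ (λ r r′ → indicator (does (r ≤? a)) + indicator (does (r′ ≤? a))) (bitReverse-even L i) (bitReverse-odd L i) ⟩
    counted L i a + indicator (does (2 ^ L + bitReverse L i ≤? a))
      ≡⟨ cong (λ z → counted L i a + z) (indicator-false (2 ^ L + bitReverse L i ≤? a)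
           (λ N+r≤a → ℕP.<-irrefl refl (ℕP.<-≤-trans a<N (ℕP.≤-trans (ℕP.m≤m+n (2 ^ L) (bitReverse L i)) N+r≤a)))) ⟩
    counted L i a + 0
      ≡⟨ ℕP.+-identityʳ _ ⟩
    counted L i a ∎))

  count-high-even : ∀ L m a → a < 2 ^ L → count (suc L) (2 * m) (2 ^ L + a) ≡ m + count L m a
  count-high-even L m a a<N = trans (ℕΣ.∑-pairs m _) (trans (ℕΣ.∑-cong m (λ i _ → begin
    counted (suc L) (2 * i) (N + a) + counted (suc L) (suc (2 * i)) (N + a)
      ≡⟨ cong₂ (λ r r′ → indicator (does (r ≤? N + a)) + indicator (does (r′ ≤? N + a))) (bitReverse-even L i) (bitReverse-odd L i) ⟩
    indicator (does (bitReverse L i ≤? N + a)) + indicator (does (N + bitReverse L i ≤? N + a))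
      ≡⟨ cong₂ _+_ (indicator-true (bitReverse L i ≤? N + a) (ℕP.≤-trans (ℕP.<⇒≤ (bitReverse-< L i)) (ℕP.m≤m+n N a)))
                   (indicator-cong (N + bitReverse L i ≤? N + a) (bitReverse L i ≤? a) (ℕP.+-cancelˡ-≤ N _ _) (ℕP.+-monoʳ-≤ N)) ⟩
    1 + counted L i a ∎))
    (trans (ℕΣ.∑-distrib m _ _) (cong (_+ count L m a) (ℕΣ.∑-ones m))))
    where N = 2 ^ L

  excess : ℕ → ℕ → ℕ → ℤ
  excess L n a = + (2 ^ L) ℤ.* + count L n a ℤ.- + n ℤ.* + a

  excess-suc : ∀ L n a → excess L (suc n) a ≡ excess L n a ℤ.+ + (2 ^ L) ℤ.* + counted L n a ℤ.- + a
  excess-suc L n a = begin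
    + N ℤ.* + count L (suc n) a ℤ.- + suc n ℤ.* + a
      ≡⟨ cong (λ c → + N ℤ.* c ℤ.- + suc n ℤ.* + a) (trans (cong +_ (count-suc L n a)) (ℤP.pos-+ (count L n a) (counted L n a))) ⟩
    + N ℤ.* (+ count L n a ℤ.+ + counted L n a) ℤ.- (ℤ.1ℤ ℤ.+ + n) ℤ.* + a
      ≡⟨ identity (+ N) (+ count L n a) (+ counted L n a) (+ n) (+ a) ⟩
    + N ℤ.* + count L n a ℤ.- + n ℤ.* + a ℤ.+ + N ℤ.* + counted L n a ℤ.- + a ∎
    where
    N = 2 ^ L
    identity : ∀ N C i n a → N ℤ.* (C ℤ.+ i) ℤ.- (ℤ.1ℤ ℤ.+ n) ℤ.* a ≡ N ℤ.* C ℤ.- n ℤ.* a ℤ.+ N ℤ.* i ℤ.- a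
    identity = solve-∀

  excess-low-even : ∀ L m a → a < 2 ^ L → excess (suc L) (2 * m) a ≡ excess L m a ℤ.+ excess L m a
  excess-low-even L m a a<N = begin
    + (2 * N) ℤ.* + count (suc L) (2 * m) a ℤ.- + (2 * m) ℤ.* + a
      ≡⟨ cong₂ (λ c d → + (2 * N) ℤ.* + c ℤ.- d ℤ.* + a) (count-low-even L m a a<N) (ℤP.pos-* 2 m) ⟩
    + (2 * N) ℤ.* + count L m a ℤ.- + 2 ℤ.* + m ℤ.* + a
      ≡⟨ cong (λ d → d ℤ.* + count L m a ℤ.- + 2 ℤ.* + m ℤ.* + a) (ℤP.pos-* 2 N) ⟩
    + 2 ℤ.* + N ℤ.* + count L m a ℤ.- + 2 ℤ.* + m ℤ.* + a
      ≡⟨ identity (+ N) (+ count L m a) (+ m) (+ a) ⟩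
    excess L m a ℤ.+ excess L m a ∎
    where
    N = 2 ^ L
    identity : ∀ N C m a → + 2 ℤ.* N ℤ.* C ℤ.- + 2 ℤ.* m ℤ.* a ≡ (N ℤ.* C ℤ.- m ℤ.* a) ℤ.+ (N ℤ.* C ℤ.- m ℤ.* a)
    identity = solve-∀

  excess-high-even : ∀ L m a → a < 2 ^ L → excess (suc L) (2 * m) (2 ^ L + a) ≡ excess L m a ℤ.+ excess L m a
  excess-high-even L m a a<N = begin
    + (2 * N) ℤ.* + count (suc L) (2 * m) (N + a) ℤ.- + (2 * m) ℤ.* + (N + a)
      ≡⟨ cong₂ (λ c d → + (2 * N) ℤ.* c ℤ.- d) (trans (cong +_ (count-high-even L m a a<N)) (ℤP.pos-+ m (count L m a)))
                                             (cong₂ ℤ._*_ (ℤP.pos-* 2 m) (ℤP.pos-+ N a)) ⟩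
    + (2 * N) ℤ.* (+ m ℤ.+ + count L m a) ℤ.- + 2 ℤ.* + m ℤ.* (+ N ℤ.+ + a)
      ≡⟨ cong (λ d → d ℤ.* (+ m ℤ.+ + count L m a) ℤ.- + 2 ℤ.* + m ℤ.* (+ N ℤ.+ + a)) (ℤP.pos-* 2 N) ⟩
    + 2 ℤ.* + N ℤ.* (+ m ℤ.+ + count L m a) ℤ.- + 2 ℤ.* + m ℤ.* (+ N ℤ.+ + a)
      ≡⟨ identity (+ N) (+ count L m a) (+ m) (+ a) ⟩
    excess L m a ℤ.+ excess L m a ∎
    where
    N = 2 ^ L
    identity : ∀ N C m a → + 2 ℤ.* N ℤ.* (m ℤ.+ C) ℤ.- + 2 ℤ.* m ℤ.* (N ℤ.+ a) ≡ (N ℤ.* C ℤ.- m ℤ.* a) ℤ.+ (N ℤ.* C ℤ.- m ℤ.* a)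
    identity = solve-∀

  excess-low-odd : ∀ L m a → a < 2 ^ L →
    excess (suc L) (suc (2 * m)) a ≡ excess L m a ℤ.+ excess L (suc m) a ℤ.+ + (2 ^ L * counted L m a)
  excess-low-odd L m a a<N = begin
    excess (suc L) (suc (2 * m)) a
      ≡⟨ excess-suc (suc L) (2 * m) a ⟩
    excess (suc L) (2 * m) a ℤ.+ + (2 * N) ℤ.* + counted (suc L) (2 * m) a ℤ.- + a
      ≡⟨ cong₂ (λ e i → e ℤ.+ + (2 * N) ℤ.* + i ℤ.- + a) (excess-low-even L m a a<N)
               (cong (λ r → indicator (does (r ≤? a))) (bitReverse-even L m)) ⟩
    Δ ℤ.+ Δ ℤ.+ + (2 * N) ℤ.* + counted L m a ℤ.- + a
      ≡⟨ cong (λ d → Δ ℤ.+ Δ ℤ.+ d ℤ.* + counted L m a ℤ.- + a) (ℤP.pos-* 2 N) ⟩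
    Δ ℤ.+ Δ ℤ.+ + 2 ℤ.* + N ℤ.* + counted L m a ℤ.- + a
      ≡⟨ identity Δ (+ N) (+ counted L m a) (+ a) ⟩
    Δ ℤ.+ (Δ ℤ.+ + N ℤ.* + counted L m a ℤ.- + a) ℤ.+ + N ℤ.* + counted L m a
      ≡⟨ cong₂ (λ e d → Δ ℤ.+ e ℤ.+ d) (sym (excess-suc L m a)) (sym (ℤP.pos-* N (counted L m a))) ⟩
    Δ ℤ.+ excess L (suc m) a ℤ.+ + (N * counted L m a) ∎
    where
    N = 2 ^ L
    Δ = excess L m a
    identity : ∀ Δ N i a → Δ ℤ.+ Δ ℤ.+ + 2 ℤ.* N ℤ.* i ℤ.- a ≡ Δ ℤ.+ (Δ ℤ.+ N ℤ.* i ℤ.- a) ℤ.+ N ℤ.* i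
    identity = solve-∀

  excess-high-odd : ∀ L m a → a < 2 ^ L →
    excess (suc L) (suc (2 * m)) (2 ^ L + a) ≡ excess L m a ℤ.+ excess L (suc m) a ℤ.+ + (2 ^ L * indicator (not (does (bitReverse L m ≤? a))))
  excess-high-odd L m a a<N = begin
    excess (suc L) (suc (2 * m)) (N + a)
      ≡⟨ excess-suc (suc L) (2 * m) (N + a) ⟩
    excess (suc L) (2 * m) (N + a) ℤ.+ + (2 * N) ℤ.* + counted (suc L) (2 * m) (N + a) ℤ.- + (N + a)
      ≡⟨ cong₂ (λ e i → e ℤ.+ + (2 * N) ℤ.* + i ℤ.- + (N + a)) (excess-high-even L m a a<N) r≤N+a ⟩
    Δ ℤ.+ Δ ℤ.+ + (2 * N) ℤ.* + 1 ℤ.- + (N + a)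
      ≡⟨ cong₂ (λ d e → Δ ℤ.+ Δ ℤ.+ d ℤ.* + 1 ℤ.- e) (ℤP.pos-* 2 N) (ℤP.pos-+ N a) ⟩
    Δ ℤ.+ Δ ℤ.+ + 2 ℤ.* + N ℤ.* + 1 ℤ.- (+ N ℤ.+ + a)
      ≡⟨ identity (does (bitReverse L m ≤? a)) Δ (+ N) (+ a) ⟩
    Δ ℤ.+ (Δ ℤ.+ + N ℤ.* + counted L m a ℤ.- + a) ℤ.+ + N ℤ.* + indicator (not (does (bitReverse L m ≤? a)))
      ≡⟨ cong₂ (λ e d → Δ ℤ.+ e ℤ.+ d) (sym (excess-suc L m a)) (sym (ℤP.pos-* N _)) ⟩
    Δ ℤ.+ excess L (suc m) a ℤ.+ + (N * indicator (not (does (bitReverse L m ≤? a)))) ∎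
    where
    N = 2 ^ L
    Δ = excess L m a
    r≤N+a : counted (suc L) (2 * m) (N + a) ≡ 1
    r≤N+a = trans (cong (λ r → indicator (does (r ≤? N + a))) (bitReverse-even L m))
      (indicator-true (bitReverse L m ≤? N + a) (ℕP.≤-trans (ℕP.<⇒≤ (bitReverse-< L m)) (ℕP.m≤m+n N a)))
    identity : ∀ b Δ N a → Δ ℤ.+ Δ ℤ.+ + 2 ℤ.* N ℤ.* + 1 ℤ.- (N ℤ.+ a) ≡
                           Δ ℤ.+ (Δ ℤ.+ N ℤ.* + indicator b ℤ.- a) ℤ.+ N ℤ.* + indicator (not b)
    identity true  = solve-∀
    identity false = solve-∀

  private
    N*indicator≤N : ∀ N b → N * indicator b ≤ N
    N*indicator≤N N true  = ℕP.≤-reflexive (ℕP.*-identityʳ N)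
    N*indicator≤N N false = ℕP.≤-trans (ℕP.≤-reflexive (ℕP.*-zeroʳ N)) z≤n

    +[2*m]≡+m++m : ∀ m → + (2 * m) ≡ + m ℤ.+ + m
    +[2*m]≡+m++m m = trans (cong (λ k → + (m + k)) (ℕP.+-identityʳ m)) (ℤP.pos-+ m m)

    +[1+2*m]≡+m++[1+m] : ∀ m → + suc (2 * m) ≡ + m ℤ.+ + suc m ℤ.+ + 0
    +[1+2*m]≡+m++[1+m] m = trans (cong +_ (trans (sym (ℕP.+-suc m (m + 0))) (cong (λ k → m + suc k) (ℕP.+-identityʳ m))))
      (trans (ℤP.pos-+ m (suc m)) (sym (ℤP.+-identityʳ _)))

    double-≤ : ∀ {m Δ e} → e ≡ Δ ℤ.+ Δ → + m ℤ.≤ Δ → + (2 * m) ℤ.≤ e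
    double-≤ {m} {Δ} refl m≤Δ = subst (ℤ._≤ Δ ℤ.+ Δ) (sym (+[2*m]≡+m++m m)) (ℤP.+-mono-≤ m≤Δ m≤Δ)

    odd-≤ : ∀ {m Δ Δ′ x e} → e ≡ Δ ℤ.+ Δ′ ℤ.+ + x → + m ℤ.≤ Δ → + suc m ℤ.≤ Δ′ → + suc (2 * m) ℤ.≤ e
    odd-≤ {m} {Δ} {Δ′} {x} refl m≤Δ 1+m≤Δ′ = subst (ℤ._≤ Δ ℤ.+ Δ′ ℤ.+ + x) (sym (+[1+2*m]≡+m++[1+m] m))
      (ℤP.+-mono-≤ (ℤP.+-mono-≤ m≤Δ 1+m≤Δ′) (ℤ.+≤+ z≤n))

    ≤-double : ∀ {U U′ Δ e} → e ≡ Δ ℤ.+ Δ → U′ ≡ U + U → Δ ℤ.≤ + U → e ℤ.≤ + U′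
    ≤-double {U} {Δ = Δ} refl refl Δ≤U = subst (Δ ℤ.+ Δ ℤ.≤_) (sym (ℤP.pos-+ U U)) (ℤP.+-mono-≤ Δ≤U Δ≤U)

    ≤-odd : ∀ {U U″ U′ N x Δ Δ′ e} → e ≡ Δ ℤ.+ Δ′ ℤ.+ + x → U′ ≡ U + U″ + N → x ≤ N →
      Δ ℤ.≤ + U → Δ′ ℤ.≤ + U″ → e ℤ.≤ + U′
    ≤-odd {U} {U″} {N = N} {x} {Δ} {Δ′} refl refl x≤N Δ≤U Δ′≤U″ =
      subst (Δ ℤ.+ Δ′ ℤ.+ + x ℤ.≤_) (sym (trans (ℤP.pos-+ (U + U″) N) (cong (ℤ._+ + N) (ℤP.pos-+ U U″))))
        (ℤP.+-mono-≤ (ℤP.+-mono-≤ Δ≤U Δ′≤U″) (ℤ.+≤+ x≤N))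

    halve-≤ : ∀ {m N} → 2 * m ≤ 2 * N → m ≤ N
    halve-≤ = ℕP.*-cancelˡ-≤ 2

    halve-< : ∀ {m N} → suc (2 * m) ≤ 2 * N → suc m ≤ N
    halve-< {m} {N} = ℕP.*-cancelˡ-< 2 m N

  excess-lower : ∀ L n a → n ≤ 2 ^ L → a < 2 ^ L → + n ℤ.≤ excess L n a
  excess-lower zero    zero          zero    _        _        = ℤP.≤-refl
  excess-lower zero    (suc zero)    zero    _        _        = ℤP.≤-refl
  excess-lower zero    (suc (suc n)) _       (s≤s ()) _
  excess-lower zero    _             (suc a) _        (s≤s ())
  excess-lower (suc L) n x n≤2N x<2N with parity n | half (2 ^ L) x x<2N
  ... | even m | lower a<N = double-≤ (excess-low-even L m _ a<N) (excess-lower L m _ (halve-≤ n≤2N) a<N)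
  ... | even m | upper a<N = double-≤ (excess-high-even L m _ a<N) (excess-lower L m _ (halve-≤ n≤2N) a<N)
  ... | odd m  | lower a<N = odd-≤ (excess-low-odd L m _ a<N)
    (excess-lower L m _ (ℕP.<⇒≤ (halve-< n≤2N)) a<N) (excess-lower L (suc m) _ (halve-< n≤2N) a<N)
  ... | odd m  | upper a<N = odd-≤ (excess-high-odd L m _ a<N)
    (excess-lower L m _ (ℕP.<⇒≤ (halve-< n≤2N)) a<N) (excess-lower L (suc m) _ (halve-< n≤2N) a<N)

  excess-upper : ∀ L n a → n ≤ 2 ^ L → a < 2 ^ L → excess L n a ℤ.≤ + walshL1 L n
  excess-upper zero    zero          zero    _        _        = ℤP.≤-refl
  excess-upper zero    (suc zero)    zero    _        _        = ℤP.≤-refl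
  excess-upper zero    (suc (suc n)) _       (s≤s ()) _
  excess-upper zero    _             (suc a) _        (s≤s ())
  excess-upper (suc L) n x n≤2N x<2N with parity n | half (2 ^ L) x x<2N
  ... | even m | lower a<N = ≤-double (excess-low-even L m _ a<N) (walshL1-even L m) (excess-upper L m _ (halve-≤ n≤2N) a<N)
  ... | even m | upper a<N = ≤-double (excess-high-even L m _ a<N) (walshL1-even L m) (excess-upper L m _ (halve-≤ n≤2N) a<N)
  ... | odd m  | lower a<N = ≤-odd (excess-low-odd L m _ a<N) (walshL1-odd L m) (N*indicator≤N (2 ^ L) _)
    (excess-upper L m _ (ℕP.<⇒≤ (halve-< n≤2N)) a<N) (excess-upper L (suc m) _ (halve-< n≤2N) a<N)
  ... | odd m  | upper a<N = ≤-odd (excess-high-odd L m _ a<N) (walshL1-odd L m) (N*indicator≤N (2 ^ L) _)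
    (excess-upper L m _ (ℕP.<⇒≤ (halve-< n≤2N)) a<N) (excess-upper L (suc m) _ (halve-< n≤2N) a<N)

  private
    double-≡ : ∀ {U U′ Δ e} → e ≡ Δ ℤ.+ Δ → U′ ≡ U + U → Δ ≡ + U → e ≡ + U′
    double-≡ {U} refl refl refl = sym (ℤP.pos-+ U U)

    odd-≡ : ∀ {U U″ U′ N x Δ Δ′ e} → e ≡ Δ ℤ.+ Δ′ ℤ.+ + x → U′ ≡ U + U″ + N → x ≡ N →
      Δ ≡ + U → Δ′ ≡ + U″ → e ≡ + U′
    odd-≡ {U} {U″} {N = N} refl refl refl refl refl = sym (trans (ℤP.pos-+ (U + U″) N) (cong (ℤ._+ + N) (ℤP.pos-+ U U″)))

    excess-attained-step : ∀ L m a → a < 2 ^ L → excess L m a ≡ + walshL1 L m → excess L (suc m) a ≡ + walshL1 L (suc m) →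
      Σ ℕ λ x → x < 2 ^ suc L × excess (suc L) (2 * m) x ≡ + walshL1 (suc L) (2 * m)
                 × excess (suc L) (suc (2 * m)) x ≡ + walshL1 (suc L) (suc (2 * m))
                 × excess (suc L) (2 * suc m) x ≡ + walshL1 (suc L) (2 * suc m)
    excess-attained-step L m a a<N Δ≡U Δ′≡U′ with bitReverse L m ≤? a
    ... | yes r≤a = a , ℕP.<-≤-trans a<N (ℕP.m≤m+n N (N + 0))
      , double-≡ (excess-low-even L m a a<N) (walshL1-even L m) Δ≡U
      , odd-≡ (excess-low-odd L m a a<N) (walshL1-odd L m)
          (trans (cong (N *_) (indicator-true (bitReverse L m ≤? a) r≤a)) (ℕP.*-identityʳ N)) Δ≡U Δ′≡U′
      , double-≡ (excess-low-even L (suc m) a a<N) (walshL1-even L (suc m)) Δ′≡U′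
      where N = 2 ^ L
    ... | no r≰a = N + a , ℕP.+-monoʳ-< N (subst (a <_) (sym (ℕP.+-identityʳ N)) a<N)
      , double-≡ (excess-high-even L m a a<N) (walshL1-even L m) Δ≡U
      , odd-≡ (excess-high-odd L m a a<N) (walshL1-odd L m)
          (trans (cong (λ b → N * indicator (not b)) (dec-false (bitReverse L m ≤? a) r≰a)) (ℕP.*-identityʳ N)) Δ≡U Δ′≡U′
      , double-≡ (excess-high-even L (suc m) a a<N) (walshL1-even L (suc m)) Δ′≡U′
      where N = 2 ^ L

  excess-attained : ∀ L n → suc n ≤ 2 ^ L →
    Σ ℕ λ a → a < 2 ^ L × excess L n a ≡ + walshL1 L n × excess L (suc n) a ≡ + walshL1 L (suc n)
  excess-attained zero    zero    _        = 0 , s≤s z≤n , refl , refl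
  excess-attained zero    (suc n) (s≤s ())
  excess-attained (suc L) n 1+n≤2N with parity n
  ... | even m with excess-attained L m (halve-< 1+n≤2N)
  ...   | a , a<N , Δ≡U , Δ′≡U′ with excess-attained-step L m a a<N Δ≡U Δ′≡U′
  ...     | x , x<2N , e₀ , e₁ , _ = x , x<2N , e₀ , e₁
  excess-attained (suc L) n 1+n≤2N | odd m with excess-attained L m (halve-≤ (subst (_≤ 2 * 2 ^ L) (sym (ℕP.*-suc 2 m)) 1+n≤2N))
  ...   | a , a<N , Δ≡U , Δ′≡U′ with excess-attained-step L m a a<N Δ≡U Δ′≡U′
  ...     | x , x<2N , _ , e₁ , e₂ = x , x<2N , e₁ , subst (λ k → excess (suc L) k x ≡ + walshL1 (suc L) k) (ℕP.*-suc 2 m) e₂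

module ℚInequalities where

  open import Data.Rational using (0ℚ; _-_; -_; _≤_; _<_; ∣_∣; _⊓_)
  import Data.Rational.Properties as ℚP
  open import Data.Rational.Solver using (module +-*-Solver)
  open +-*-Solver using (solve; _:+_; _:-_; :-_; _:=_)
  open import Data.Sum using (inj₁; inj₂)
  open ≡

  p≤q⇒0≤q-p : ∀ {p q} → p ≤ q → 0ℚ ≤ q - p
  p≤q⇒0≤q-p {p} {q} p≤q = subst (_≤ q - p) (ℚP.+-inverseʳ p) (ℚP.+-monoˡ-≤ (- p) p≤q)

  p<q⇒0<q-p : ∀ {p q} → p < q → 0ℚ < q - p
  p<q⇒0<q-p {p} {q} p<q = subst (_< q - p) (ℚP.+-inverseʳ p) (ℚP.+-monoˡ-< (- p) p<q)

  0≤q-p⇒p≤q : ∀ {p q} → 0ℚ ≤ q - p → p ≤ q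
  0≤q-p⇒p≤q {p} {q} 0≤q-p = subst₂ _≤_ (ℚP.+-identityˡ p) (solve 2 (λ p q → q :- p :+ p := q) refl p q) (ℚP.+-monoˡ-≤ p 0≤q-p)

  p-q<p : ∀ {p q} → 0ℚ < q → p - q < p
  p-q<p {p} {q} 0<q = subst (p - q <_) (ℚP.+-identityʳ p) (ℚP.+-monoʳ-< p (ℚP.neg-antimono-< 0<q))

  0<p⊓q : ∀ {p q} → 0ℚ < p → 0ℚ < q → 0ℚ < p ⊓ q
  0<p⊓q {p} {q} 0<p 0<q with ℚP.⊓-sel p q
  ... | inj₁ p⊓q≡p = subst (0ℚ <_) (sym p⊓q≡p) 0<p
  ... | inj₂ p⊓q≡q = subst (0ℚ <_) (sym p⊓q≡q) 0<q

  <⇒≱ : ∀ {p q} → p < q → ¬ (q ≤ p)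
  <⇒≱ p<q q≤p = ℚP.<-irrefl refl (ℚP.<-≤-trans p<q q≤p)

  ∣p-q∣≤r : ∀ {p q r} → 0ℚ ≤ p → p ≤ r → 0ℚ ≤ q → q ≤ r → ∣ p - q ∣ ≤ r
  ∣p-q∣≤r {p} {q} {r} 0≤p p≤r 0≤q q≤r with ℚP.∣p∣≡p∨∣p∣≡-p (p - q)
  ... | inj₁ ∣p-q∣≡p-q = subst (_≤ r) (sym ∣p-q∣≡p-q)
    (ℚP.≤-trans (subst (p - q ≤_) (ℚP.+-identityʳ p) (ℚP.+-monoʳ-≤ p (ℚP.neg-antimono-≤ 0≤q))) p≤r)
  ... | inj₂ ∣p-q∣≡q-p = subst (_≤ r) (sym (trans ∣p-q∣≡q-p (solve 2 (λ p q → :- (p :- q) := q :- p) refl p q)))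
    (ℚP.≤-trans (subst (q - p ≤_) (ℚP.+-identityʳ q) (ℚP.+-monoʳ-≤ q (ℚP.neg-antimono-≤ 0≤p))) q≤r)

module RiemannSums where

  open import Data.Rational as ℚ using (ℚ; 0ℚ; 1ℚ; _+_; _*_; _-_; -_; _≤_; _<_; ∣_∣; _⊔_; _⊓_)
  import Data.Rational.Properties as ℚP
  open import Data.Rational.Solver using (module +-*-Solver)
  open +-*-Solver using (solve; _:+_; _:*_; _:-_; _:=_; con)
  open import Data.Sum using (_⊎_; inj₁; inj₂)
  open import Data.Product using (proj₁; proj₂)
  open import Data.Empty using (⊥-elim)
  open import Relation.Binary.Definitions using (tri<; tri≈; tri>)
  open ℚInequalities
  open ≡

  endpoints-< : ∀ {a b} → TaggedPartition a b → a < b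
  endpoints-< (last _ a<b _ _)   = a<b
  endpoints-< (step _ a<b _ _ P) = ℚP.<-trans a<b (endpoints-< P)

  0≤mesh : ∀ {a b} (P : TaggedPartition a b) → 0ℚ ≤ mesh P
  0≤mesh (last _ a<b _ _)   = ℚP.<⇒≤ (p<q⇒0<q-p a<b)
  0≤mesh (step _ a<b _ _ P) = ℚP.≤-trans (ℚP.<⇒≤ (p<q⇒0<q-p a<b)) (ℚP.p≤p⊔q _ _)

  riemannSum-cong : ∀ {p q} (P : TaggedPartition p q) (f g : ℚ → ℚ) →
    (∀ x → p ≤ x → x ≤ q → f x ≡ g x) → riemannSum f P ≡ riemannSum g P
  riemannSum-cong (last t _ p≤t t≤q) f g f≡g = cong (_* _) (f≡g t p≤t t≤q)
  riemannSum-cong (step t p<b p≤t t≤b P) f g f≡g = cong₂ _+_ (cong (_* _) (f≡g t p≤t (ℚP.≤-trans t≤b (ℚP.<⇒≤ (endpoints-< P)))))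
    (riemannSum-cong P f g (λ x b≤x x≤q → f≡g x (ℚP.≤-trans (ℚP.<⇒≤ p<b) b≤x) x≤q))

  riemannSum-+ : ∀ {p q} (P : TaggedPartition p q) (f g : ℚ → ℚ) →
    riemannSum (λ x → f x + g x) P ≡ riemannSum f P + riemannSum g P
  riemannSum-+ (last t _ _ _) f g = ℚP.*-distribʳ-+ _ (f t) (g t)
  riemannSum-+ {p} (step {b = b} t _ _ _ P) f g = trans (cong₂ _+_ (ℚP.*-distribʳ-+ _ (f t) (g t)) (riemannSum-+ P f g))
    (solve 4 (λ a b c d → (a :+ b) :+ (c :+ d) := (a :+ c) :+ (b :+ d)) refl
      (f t * (b - p)) (g t * (b - p)) (riemannSum f P) (riemannSum g P))

  riemannSum-*ˡ : ∀ {p q} (P : TaggedPartition p q) c (f : ℚ → ℚ) → riemannSum (λ x → c * f x) P ≡ c * riemannSum f P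
  riemannSum-*ˡ (last t _ _ _) c f = ℚP.*-assoc c (f t) _
  riemannSum-*ˡ (step t _ _ _ P) c f = trans (cong₂ _+_ (ℚP.*-assoc c (f t) _) (riemannSum-*ˡ P c f)) (sym (ℚP.*-distribˡ-+ c _ _))

  riemannSum-∑ : ∀ {p q} (P : TaggedPartition p q) n (F : ℕ → ℚ → ℚ) →
    riemannSum (λ x → ℚΣ.∑ n (λ a → F a x)) P ≡ ℚΣ.∑ n (λ a → riemannSum (F a) P)
  riemannSum-∑ P zero    F = zero-sum P
    where
    zero-sum : ∀ {p q} (P : TaggedPartition p q) → riemannSum (λ _ → 0ℚ) P ≡ 0ℚ
    zero-sum {p} {q} (last _ _ _ _)      = ℚP.*-zeroˡ (q - p)
    zero-sum {p} (step {b = b} _ _ _ _ P) = trans (cong₂ _+_ (ℚP.*-zeroˡ (b - p)) (zero-sum P)) (ℚP.+-identityˡ 0ℚ)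
  riemannSum-∑ P (suc n) F = trans (riemannSum-+ P (F 0) (λ x → ℚΣ.∑ n (λ a → F (suc a) x)))
    (cong (riemannSum (F 0) P +_) (riemannSum-∑ P n (F ∘ suc)))

  clamp : ℚ → ℚ → ℚ → ℚ
  clamp c d x = d ⊓ (c ⊔ x)

  private
    ⊔-increment : ∀ c {x y} → x ≤ y → 0ℚ ≤ (c ⊔ y) - (c ⊔ x) × (c ⊔ y) - (c ⊔ x) ≤ y - x
    ⊔-increment c {x} {y} x≤y with ℚP.≤-total c x
    ... | inj₁ c≤x rewrite ℚP.p≤q⇒p⊔q≡q c≤x | ℚP.p≤q⇒p⊔q≡q (ℚP.≤-trans c≤x x≤y) = p≤q⇒0≤q-p x≤y , ℚP.≤-refl
    ... | inj₂ x≤c with ℚP.≤-total c y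
    ...   | inj₁ c≤y rewrite ℚP.p≥q⇒p⊔q≡p x≤c | ℚP.p≤q⇒p⊔q≡q c≤y = p≤q⇒0≤q-p c≤y , ℚP.+-monoʳ-≤ y (ℚP.neg-antimono-≤ x≤c)
    ...   | inj₂ y≤c rewrite ℚP.p≥q⇒p⊔q≡p x≤c | ℚP.p≥q⇒p⊔q≡p y≤c =
      ℚP.≤-reflexive (sym (ℚP.+-inverseʳ c)) , subst (_≤ y - x) (sym (ℚP.+-inverseʳ c)) (p≤q⇒0≤q-p x≤y)

    ⊓-increment : ∀ d {x y} → x ≤ y → 0ℚ ≤ (d ⊓ y) - (d ⊓ x) × (d ⊓ y) - (d ⊓ x) ≤ y - x
    ⊓-increment d {x} {y} x≤y with ℚP.≤-total y d
    ... | inj₁ y≤d rewrite ℚP.p≥q⇒p⊓q≡q y≤d | ℚP.p≥q⇒p⊓q≡q (ℚP.≤-trans x≤y y≤d) = p≤q⇒0≤q-p x≤y , ℚP.≤-refl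
    ... | inj₂ d≤y with ℚP.≤-total x d
    ...   | inj₁ x≤d rewrite ℚP.p≤q⇒p⊓q≡p d≤y | ℚP.p≥q⇒p⊓q≡q x≤d = p≤q⇒0≤q-p x≤d , ℚP.+-monoˡ-≤ (- x) d≤y
    ...   | inj₂ d≤x rewrite ℚP.p≤q⇒p⊓q≡p d≤y | ℚP.p≤q⇒p⊓q≡p d≤x =
      ℚP.≤-reflexive (sym (ℚP.+-inverseʳ d)) , subst (_≤ y - x) (sym (ℚP.+-inverseʳ d)) (p≤q⇒0≤q-p x≤y)

  clamp-increment : ∀ c d {x y} → x ≤ y → 0ℚ ≤ clamp c d y - clamp c d x × clamp c d y - clamp c d x ≤ y - x
  clamp-increment c d {x} {y} x≤y = proj₁ ⊓-inc , ℚP.≤-trans (proj₂ ⊓-inc) (proj₂ ⊔-inc)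
    where
    ⊔-inc : 0ℚ ≤ (c ⊔ y) - (c ⊔ x) × (c ⊔ y) - (c ⊔ x) ≤ y - x
    ⊔-inc = ⊔-increment c x≤y
    ⊓-inc : 0ℚ ≤ clamp c d y - clamp c d x × clamp c d y - clamp c d x ≤ (c ⊔ y) - (c ⊔ x)
    ⊓-inc = ⊓-increment d (0≤q-p⇒p≤q (proj₁ ⊔-inc))

  clamp-below : ∀ {c d x} → x ≤ c → c ≤ d → clamp c d x ≡ c
  clamp-below x≤c c≤d rewrite ℚP.p≥q⇒p⊔q≡p x≤c = ℚP.p≥q⇒p⊓q≡q c≤d

  clamp-above : ∀ {c d x} → d ≤ x → c ≤ d → clamp c d x ≡ d
  clamp-above d≤x c≤d rewrite ℚP.p≤q⇒p⊔q≡q (ℚP.≤-trans c≤d d≤x) = ℚP.p≤q⇒p⊓q≡p d≤x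

  clamp-inside : ∀ {c d x} → c ≤ x → x ≤ d → clamp c d x ≡ x
  clamp-inside c≤x x≤d rewrite ℚP.p≤q⇒p⊔q≡q c≤x = ℚP.p≥q⇒p⊓q≡q x≤d

  whenBoth : ∀ {p q} {P : Set p} {Q : Set q} → Dec P → Dec Q → ℚ → ℚ
  whenBoth (yes _) (yes _) v = v
  whenBoth _       _       _ = 0ℚ

  module _ {p q} {P : Set p} {Q : Set q} where

    whenBoth-yes : ∀ (P? : Dec P) (Q? : Dec Q) v → P → Q → whenBoth P? Q? v ≡ v
    whenBoth-yes (yes _) (yes _)  v _ _ = refl
    whenBoth-yes (yes _) (no ¬q)  v _ q = ⊥-elim (¬q q)
    whenBoth-yes (no ¬p) _        v p _ = ⊥-elim (¬p p)

    whenBoth-noˡ : ∀ (P? : Dec P) (Q? : Dec Q) v → ¬ P → whenBoth P? Q? v ≡ 0ℚ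
    whenBoth-noˡ (yes p) _ v ¬p = ⊥-elim (¬p p)
    whenBoth-noˡ (no _)  _ v _  = refl

    whenBoth-noʳ : ∀ (P? : Dec P) (Q? : Dec Q) v → ¬ Q → whenBoth P? Q? v ≡ 0ℚ
    whenBoth-noʳ (yes _) (yes q) v ¬q = ⊥-elim (¬q q)
    whenBoth-noʳ (yes _) (no _)  v _  = refl
    whenBoth-noʳ (no _)  _       v _  = refl

    whenBoth-bounds : ∀ (P? : Dec P) (Q? : Dec Q) {v} → 0ℚ ≤ v → 0ℚ ≤ whenBoth P? Q? v × whenBoth P? Q? v ≤ v
    whenBoth-bounds (yes _) (yes _) 0≤v = 0≤v , ℚP.≤-refl
    whenBoth-bounds (yes _) (no _)  0≤v = ℚP.≤-refl , 0≤v
    whenBoth-bounds (no _)  _       0≤v = ℚP.≤-refl , 0≤v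

  straddle : ℚ → ℚ → ℚ → ℚ
  straddle c a b = whenBoth (a ℚP.≤? c) (c ℚP.≤? b) (b - a)

  straddle-bounds : ∀ c {a b} → a < b → 0ℚ ≤ straddle c a b × straddle c a b ≤ b - a
  straddle-bounds c {a} {b} a<b = whenBoth-bounds (a ℚP.≤? c) (c ℚP.≤? b) (ℚP.<⇒≤ (p<q⇒0<q-p a<b))

  straddleWeight : ℚ → ∀ {a b} → TaggedPartition a b → ℚ
  straddleWeight c {a} {b} (last _ _ _ _)      = straddle c a b
  straddleWeight c {a} (step {b = b} _ _ _ _ P) = straddle c a b + straddleWeight c P

  straddleWeight-below : ∀ c {a b} (P : TaggedPartition a b) → c < a → straddleWeight c P ≡ 0ℚ
  straddleWeight-below c {a} {b} (last _ _ _ _) c<a = whenBoth-noˡ (a ℚP.≤? c) (c ℚP.≤? b) (b - a) (<⇒≱ c<a)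
  straddleWeight-below c {a} (step {b = b} _ a<b _ _ P) c<a = trans
    (cong₂ _+_ (whenBoth-noˡ (a ℚP.≤? c) (c ℚP.≤? b) (b - a) (<⇒≱ c<a)) (straddleWeight-below c P (ℚP.<-trans c<a a<b)))
    (ℚP.+-identityˡ 0ℚ)

  straddleWeight-start : ∀ {a b} (P : TaggedPartition a b) → straddleWeight a P ≤ mesh P
  straddleWeight-start (last _ a<b _ _) = proj₂ (straddle-bounds _ a<b)
  straddleWeight-start {a} (step {b = b} _ a<b _ _ P) = ℚP.≤-trans
    (ℚP.≤-reflexive (trans (cong (straddle a a b +_) (straddleWeight-below a P a<b)) (ℚP.+-identityʳ _)))
    (ℚP.≤-trans (proj₂ (straddle-bounds a a<b)) (ℚP.p≤p⊔q _ _))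

  private
    m≤m+m : ∀ {m} → 0ℚ ≤ m → m ≤ m + m
    m≤m+m {m} 0≤m = subst (_≤ m + m) (ℚP.+-identityʳ m) (ℚP.+-monoʳ-≤ m 0≤m)

  -- c lies in at most two consecutive subintervals.
  straddleWeight≤2mesh : ∀ c {a b} (P : TaggedPartition a b) → straddleWeight c P ≤ mesh P + mesh P
  straddleWeight≤2mesh c P@(last _ a<b _ _) = ℚP.≤-trans (proj₂ (straddle-bounds c a<b)) (m≤m+m (0≤mesh P))
  straddleWeight≤2mesh c {a} P@(step {b = b} _ a<b _ _ P′) with ℚP.<-cmp c b
  ... | tri< c<b _ _ = ℚP.≤-trans
    (ℚP.≤-reflexive (trans (cong (straddle c a b +_) (straddleWeight-below c P′ c<b)) (ℚP.+-identityʳ _)))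
    (ℚP.≤-trans (proj₂ (straddle-bounds c a<b)) (ℚP.≤-trans (ℚP.p≤p⊔q _ _) (m≤m+m (0≤mesh P))))
  ... | tri≈ _ refl _ = ℚP.+-mono-≤
    (ℚP.≤-trans (proj₂ (straddle-bounds c a<b)) (ℚP.p≤p⊔q (c - a) (mesh P′)))
    (ℚP.≤-trans (straddleWeight-start P′) (ℚP.p≤q⊔p (c - a) (mesh P′)))
  ... | tri> _ _ b<c = ℚP.≤-trans
    (ℚP.≤-reflexive (trans (cong (_+ straddleWeight c P′) (whenBoth-noʳ (a ℚP.≤? c) (c ℚP.≤? b) (b - a) (<⇒≱ b<c))) (ℚP.+-identityˡ _)))
    (ℚP.≤-trans (straddleWeight≤2mesh c P′) (ℚP.+-mono-≤ (ℚP.p≤q⊔p (b - a) (mesh P′)) (ℚP.p≤q⊔p (b - a) (mesh P′))))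

  module IndicatorLike (c d : ℚ) (c≤d : c ≤ d) (h : ℚ → ℚ)
    (h∈[0,1] : ∀ x → 0ℚ ≤ h x × h x ≤ 1ℚ)
    (h-inside : ∀ x → c < x → x < d → h x ≡ 1ℚ)
    (h-outside : ∀ x → x < c ⊎ d < x → h x ≡ 0ℚ) where

    G = clamp c d

    cell-error : ∀ {a b} t → a < b → a ≤ t → t ≤ b →
      ∣ h t * (b - a) - (G b - G a) ∣ ≤ straddle c a b + straddle d a b
    cell-error {a} {b} t a<b a≤t t≤b = by-cases (a ℚP.≤? c) (c ℚP.≤? b) (a ℚP.≤? d) (d ℚP.≤? b)
      where
      L = b - a
      instance
        L≥0 : ℚ.NonNegative L
        L≥0 = ℚ.nonNegative (ℚP.<⇒≤ (p<q⇒0<q-p a<b))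
      error≤L : ∣ h t * L - (G b - G a) ∣ ≤ L
      error≤L = ∣p-q∣≤r
        (subst (_≤ h t * L) (ℚP.*-zeroˡ L) (ℚP.*-monoʳ-≤-nonNeg L (proj₁ (h∈[0,1] t))))
        (subst (h t * L ≤_) (ℚP.*-identityˡ L) (ℚP.*-monoʳ-≤-nonNeg L (proj₂ (h∈[0,1] t))))
        (proj₁ (clamp-increment c d (ℚP.<⇒≤ a<b))) (proj₂ (clamp-increment c d (ℚP.<⇒≤ a<b)))
      0≤c : 0ℚ ≤ straddle c a b
      0≤c = proj₁ (straddle-bounds c a<b)
      0≤d : 0ℚ ≤ straddle d a b
      0≤d = proj₁ (straddle-bounds d a<b)
      exact : h t * L - (G b - G a) ≡ 0ℚ → ∣ h t * L - (G b - G a) ∣ ≤ straddle c a b + straddle d a b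
      exact e = subst (λ z → ∣ z ∣ ≤ straddle c a b + straddle d a b) (sym e) (ℚP.+-mono-≤ 0≤c 0≤d)
      outside : ∀ {u gb ga e} → u ≡ 0ℚ → gb ≡ e → ga ≡ e → u * L - (gb - ga) ≡ 0ℚ
      outside {e = e} refl refl refl = solve 2 (λ L e → con 0ℚ :* L :- (e :- e) := con 0ℚ) refl L e
      inside : ∀ {u gb ga} → u ≡ 1ℚ → gb ≡ b → ga ≡ a → u * L - (gb - ga) ≡ 0ℚ
      inside refl refl refl = solve 2 (λ a b → con 1ℚ :* (b :- a) :- (b :- a) := con 0ℚ) refl a b
      by-cases : Dec (a ≤ c) → Dec (c ≤ b) → Dec (a ≤ d) → Dec (d ≤ b) →
        ∣ h t * L - (G b - G a) ∣ ≤ straddle c a b + straddle d a b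
      by-cases (yes a≤c) (yes c≤b) _ _ = ℚP.≤-trans error≤L (subst (_≤ straddle c a b + straddle d a b) (ℚP.+-identityʳ L)
        (ℚP.+-mono-≤ (ℚP.≤-reflexive (sym (whenBoth-yes (a ℚP.≤? c) (c ℚP.≤? b) L a≤c c≤b))) 0≤d))
      by-cases _ _ (yes a≤d) (yes d≤b) = ℚP.≤-trans error≤L (subst (_≤ straddle c a b + straddle d a b) (ℚP.+-identityˡ L)
        (ℚP.+-mono-≤ 0≤c (ℚP.≤-reflexive (sym (whenBoth-yes (a ℚP.≤? d) (d ℚP.≤? b) L a≤d d≤b)))))
      by-cases (yes a≤c) (no c≰b) _ _ = exact (outside (h-outside t (inj₁ (ℚP.≤-<-trans t≤b b<c)))
        (clamp-below (ℚP.<⇒≤ b<c) c≤d) (clamp-below a≤c c≤d))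
        where b<c = ℚP.≰⇒> c≰b
      by-cases (no a≰c) (yes c≤b) (yes a≤d) (no d≰b) = exact (inside (h-inside t (ℚP.<-≤-trans c<a a≤t) (ℚP.≤-<-trans t≤b b<d))
        (clamp-inside c≤b (ℚP.<⇒≤ b<d)) (clamp-inside (ℚP.<⇒≤ c<a) a≤d))
        where
        c<a : c < a
        c<a = ℚP.≰⇒> a≰c
        b<d : b < d
        b<d = ℚP.≰⇒> d≰b
      by-cases (no a≰c) (yes c≤b) (no a≰d) _ = exact (outside (h-outside t (inj₂ (ℚP.<-≤-trans d<a a≤t)))
        (clamp-above (ℚP.<⇒≤ (ℚP.<-trans d<a a<b)) c≤d) (clamp-above (ℚP.<⇒≤ d<a) c≤d))
        where d<a = ℚP.≰⇒> a≰d
      by-cases (no a≰c) (no c≰b) _ _ = ⊥-elim (ℚP.<-asym (ℚP.<-trans (ℚP.≰⇒> a≰c) a<b) (ℚP.≰⇒> c≰b))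

    riemannSum-error : ∀ {p q} (P : TaggedPartition p q) →
      ∣ riemannSum h P - (G q - G p) ∣ ≤ straddleWeight c P + straddleWeight d P
    riemannSum-error (last t p<q p≤t t≤q) = cell-error t p<q p≤t t≤q
    riemannSum-error {p} {q} (step {b = b} t p<b p≤t t≤b P) = begin
      ∣ h t * (b - p) + riemannSum h P - (G q - G p) ∣
        ≡⟨ cong ∣_∣ (solve 5 (λ A R Gq Gb Gp → A :+ R :- (Gq :- Gp) := (A :- (Gb :- Gp)) :+ (R :- (Gq :- Gb))) refl
                       (h t * (b - p)) (riemannSum h P) (G q) (G b) (G p)) ⟩
      ∣ (h t * (b - p) - (G b - G p)) + (riemannSum h P - (G q - G b)) ∣
        ≤⟨ ℚP.∣p+q∣≤∣p∣+∣q∣ (h t * (b - p) - (G b - G p)) (riemannSum h P - (G q - G b)) ⟩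
      ∣ h t * (b - p) - (G b - G p) ∣ + ∣ riemannSum h P - (G q - G b) ∣
        ≤⟨ ℚP.+-mono-≤ (cell-error t p<b p≤t t≤b) (riemannSum-error P) ⟩
      (straddle c p b + straddle d p b) + (straddleWeight c P + straddleWeight d P)
        ≡⟨ solve 4 (λ a b c d → (a :+ b) :+ (c :+ d) := (a :+ c) :+ (b :+ d)) refl
             (straddle c p b) (straddle d p b) (straddleWeight c P) (straddleWeight d P) ⟩
      (straddle c p b + straddleWeight c P) + (straddle d p b + straddleWeight d P) ∎
      where open ℚP.≤-Reasoning

    riemannSum-error-01 : ∀ (P : TaggedPartition 0ℚ 1ℚ) → 0ℚ ≤ c → d ≤ 1ℚ →
      ∣ riemannSum h P - (d - c) ∣ ≤ (mesh P + mesh P) + (mesh P + mesh P)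
    riemannSum-error-01 P 0≤c d≤1 =
      subst (λ z → ∣ riemannSum h P - z ∣ ≤ _) (cong₂ _-_ (clamp-above d≤1 c≤d) (clamp-below 0≤c c≤d))
        (ℚP.≤-trans (riemannSum-error P) (ℚP.+-mono-≤ (straddleWeight≤2mesh c P) (straddleWeight≤2mesh d P)))

module StepFunctions where

  open import Data.Rational as ℚ using (ℚ; 0ℚ; 1ℚ; _+_; _*_; _-_; -_; _≤_; _<_; ∣_∣)
  import Data.Rational.Properties as ℚP
  open import Data.Rational.Solver using (module +-*-Solver)
  open +-*-Solver using (solve; _:+_; _:*_; _:-_; _:=_; con)
  open import Data.Sum using (_⊎_; inj₁; inj₂)
  open import Data.Empty using (⊥-elim)
  open import Relation.Binary.Definitions using (tri<; tri≈; tri>)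
  open Embedding
  open DyadicCells using (InCell)
  open ℚInequalities
  open RiemannSums
  open ≡

  locate-≤< : ∀ K X → 0ℚ ≤ X → X < fromℕ K → Σ ℕ λ a → a ℕ.< K × fromℕ a ≤ X × X < fromℕ (suc a)
  locate-≤< zero    X 0≤X X<0 = ⊥-elim (<⇒≱ X<0 0≤X)
  locate-≤< (suc K) X 0≤X X<K+1 with fromℕ K ℚP.≤? X
  ... | yes K≤X = K , ℕP.≤-refl , K≤X , X<K+1
  ... | no K≰X with locate-≤< K X 0≤X (ℚP.≰⇒> K≰X)
  ...   | a , a<K , a≤X , X<a+1 = a , ℕP.m≤n⇒m≤1+n a<K , a≤X , X<a+1

  locate-<≤ : ∀ K X → 0ℚ < X → X ≤ fromℕ K → Σ ℕ λ a → a ℕ.< K × fromℕ a < X × X ≤ fromℕ (suc a)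
  locate-<≤ zero    X 0<X X≤0 = ⊥-elim (<⇒≱ 0<X X≤0)
  locate-<≤ (suc K) X 0<X X≤K+1 with X ℚP.≤? fromℕ K
  ... | no X≰K = K , ℕP.≤-refl , ℚP.≰⇒> X≰K , X≤K+1
  ... | yes X≤K with locate-<≤ K X 0<X X≤K
  ...   | a , a<K , a<X , X≤a+1 = a , ℕP.m≤n⇒m≤1+n a<K , a<X , X≤a+1

  module StepFunction (N : ℕ) .{{_ : ℕ.NonZero N}} (f : ℚ → ℚ) (g : ℕ → ℚ)
    (∣f∣≤1 : ∀ x → 0ℚ ≤ x → x ≤ 1ℚ → ∣ f x ∣ ≤ 1ℚ)
    (f-step : ∀ a x → a ℕ.< N → InCell N a x → f x ≡ g a) where

    private
      n = fromℕ N
      w = 1/ℕ N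
      instance
        n>0 : ℚ.Positive n
        n>0 = fromℕ-pos N
        w>0 : ℚ.Positive w
        w>0 = 1/ℕ-pos N
        n≥0 : ℚ.NonNegative n
        n≥0 = ℚP.pos⇒nonNeg n
        w≥0 : ℚ.NonNegative w
        w≥0 = ℚP.pos⇒nonNeg w

    χ : ℕ → ℚ → ℚ
    χ a x = whenBoth (fromℕ a ℚP.≤? n * x) (n * x ℚP.<? fromℕ (suc a)) 1ℚ

    -- f 1 need not be the value on the last cell (all binary digits of 1 vanish),
    -- so the point 1 gets its own indicator.
    χ₁ : ℚ → ℚ
    χ₁ x = whenBoth (1ℚ ℚP.≤? x) (x ℚP.≤? 1ℚ) 1ℚ

    private
      left right : ℕ → ℚ
      left a  = fromℕ a * w
      right a = fromℕ (suc a) * w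

      n*[k*w]≡k : ∀ k → n * (fromℕ k * w) ≡ fromℕ k
      n*[k*w]≡k k = trans (solve 3 (λ n k w → n :* (k :* w) := k :* (n :* w)) refl n (fromℕ k) w)
        (trans (cong (fromℕ k *_) (fromℕ*1/ℕ N)) (ℚP.*-identityʳ _))

      scale-< : ∀ {x y} → x < y → n * x < n * y
      scale-< = ℚP.*-monoʳ-<-pos n

      0≤1 : 0ℚ ≤ 1ℚ
      0≤1 = ℚP.<⇒≤ (ℚP.positive⁻¹ 1ℚ)

      χ-inside : ∀ a x → left a < x → x < right a → χ a x ≡ 1ℚ
      χ-inside a x l<x x<r = whenBoth-yes (fromℕ a ℚP.≤? n * x) (n * x ℚP.<? fromℕ (suc a)) 1ℚ
        (ℚP.<⇒≤ (subst (_< n * x) (n*[k*w]≡k a) (scale-< l<x))) (subst (n * x <_) (n*[k*w]≡k (suc a)) (scale-< x<r))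

      χ-outside : ∀ a x → x < left a ⊎ right a < x → χ a x ≡ 0ℚ
      χ-outside a x (inj₁ x<l) = whenBoth-noˡ (fromℕ a ℚP.≤? n * x) (n * x ℚP.<? fromℕ (suc a)) 1ℚ
        (<⇒≱ (subst (n * x <_) (n*[k*w]≡k a) (scale-< x<l)))
      χ-outside a x (inj₂ r<x) = whenBoth-noʳ (fromℕ a ℚP.≤? n * x) (n * x ℚP.<? fromℕ (suc a)) 1ℚ
        (λ nx<a+1 → <⇒≱ (subst (_< n * x) (n*[k*w]≡k (suc a)) (scale-< r<x)) (ℚP.<⇒≤ nx<a+1))

      χ-bounds : ∀ a x → 0ℚ ≤ χ a x × χ a x ≤ 1ℚ
      χ-bounds a x = whenBoth-bounds (fromℕ a ℚP.≤? n * x) (n * x ℚP.<? fromℕ (suc a)) 0≤1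

      χ₁-inside : ∀ x → 1ℚ < x → x < 1ℚ → χ₁ x ≡ 1ℚ
      χ₁-inside x 1<x x<1 = ⊥-elim (ℚP.<-asym 1<x x<1)

      χ₁-outside : ∀ x → x < 1ℚ ⊎ 1ℚ < x → χ₁ x ≡ 0ℚ
      χ₁-outside x (inj₁ x<1) = whenBoth-noˡ (1ℚ ℚP.≤? x) (x ℚP.≤? 1ℚ) 1ℚ (<⇒≱ x<1)
      χ₁-outside x (inj₂ 1<x) = whenBoth-noʳ (1ℚ ℚP.≤? x) (x ℚP.≤? 1ℚ) 1ℚ (<⇒≱ 1<x)

      χ₁-bounds : ∀ x → 0ℚ ≤ χ₁ x × χ₁ x ≤ 1ℚ
      χ₁-bounds x = whenBoth-bounds (1ℚ ℚP.≤? x) (x ℚP.≤? 1ℚ) 0≤1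

      left≤right : ∀ a → left a ≤ right a
      left≤right a = ℚP.*-monoʳ-≤-nonNeg w (fromℕ-mono-≤ (ℕP.n≤1+n a))

      0≤left : ∀ a → 0ℚ ≤ left a
      0≤left a = subst (_≤ left a) (ℚP.*-zeroˡ w) (ℚP.*-monoʳ-≤-nonNeg w (fromℕ-mono-≤ {0} {a} z≤n))

      right≤1 : ∀ a → a ℕ.< N → right a ≤ 1ℚ
      right≤1 a a<N = subst (right a ≤_) (fromℕ*1/ℕ N) (ℚP.*-monoʳ-≤-nonNeg w (fromℕ-mono-≤ a<N))

      right-left≡w : ∀ a → right a - left a ≡ w
      right-left≡w a = trans (cong (λ r → r * w - left a) (fromℕ-+ 1 a))
        (solve 2 (λ A w → (con 1ℚ :+ A) :* w :- A :* w := w) refl (fromℕ a) w)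

      ∣g∣≤1 : ∀ a → a ℕ.< N → ∣ g a ∣ ≤ 1ℚ
      ∣g∣≤1 a a<N = subst (λ z → ∣ z ∣ ≤ 1ℚ)
        (f-step a (left a) a<N (ℚP.≤-reflexive (sym (n*[k*w]≡k a))
          , subst (_< fromℕ (suc a)) (sym (n*[k*w]≡k a)) (fromℕ-mono-< (ℕP.n<1+n a))))
        (∣f∣≤1 (left a) (0≤left a) (ℚP.≤-trans (left≤right a) (right≤1 a a<N)))

      ∣p*q∣≤r : ∀ {p q r} → ∣ p ∣ ≤ 1ℚ → ∣ q ∣ ≤ r → ∣ p * q ∣ ≤ r
      ∣p*q∣≤r {p} {q} {r} ∣p∣≤1 ∣q∣≤r = ℚP.≤-trans (ℚP.≤-reflexive (ℚP.∣p*q∣≡∣p∣*∣q∣ p q))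
        (ℚP.≤-trans (ℚP.*-monoʳ-≤-nonNeg ∣ q ∣ {{ℚ.nonNegative (ℚP.0≤∣p∣ q)}} ∣p∣≤1)
          (subst (_≤ r) (sym (ℚP.*-identityˡ ∣ q ∣)) ∣q∣≤r))

    step-decomposition : ∀ x → 0ℚ ≤ x → x ≤ 1ℚ → f x ≡ ℚΣ.∑ N (λ a → g a * χ a x) + f 1ℚ * χ₁ x
    step-decomposition x 0≤x x≤1 = by-cases (1ℚ ℚP.≤? x)
      where
      at-one : f 1ℚ ≡ ℚΣ.∑ N (λ a → g a * χ a 1ℚ) + f 1ℚ * χ₁ 1ℚ
      at-one = sym (trans (cong₂ _+_ (ℚΣ.∑-ε N (λ a a<N → trans (cong (g a *_) (χ-at-one a a<N)) (ℚP.*-zeroʳ (g a))))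
                                     (cong (f 1ℚ *_) (whenBoth-yes (1ℚ ℚP.≤? 1ℚ) (1ℚ ℚP.≤? 1ℚ) 1ℚ ℚP.≤-refl ℚP.≤-refl)))
                    (trans (ℚP.+-identityˡ _) (ℚP.*-identityʳ (f 1ℚ))))
        where
        χ-at-one : ∀ a → a ℕ.< N → χ a 1ℚ ≡ 0ℚ
        χ-at-one a a<N = whenBoth-noʳ (fromℕ a ℚP.≤? n * 1ℚ) (n * 1ℚ ℚP.<? fromℕ (suc a)) 1ℚ
          (λ n<a+1 → <⇒≱ n<a+1 (subst (fromℕ (suc a) ≤_) (sym (ℚP.*-identityʳ n)) (fromℕ-mono-≤ a<N)))
      in-cell : x < 1ℚ → f x ≡ ℚΣ.∑ N (λ a → g a * χ a x) + f 1ℚ * χ₁ x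
      in-cell x<1 with locate-≤< N (n * x)
                         (subst (_≤ n * x) (ℚP.*-zeroʳ n) (ℚP.*-monoˡ-≤-nonNeg n 0≤x))
                         (subst (n * x <_) (ℚP.*-identityʳ n) (scale-< x<1))
      ... | a₀ , a₀<N , a₀≤nx , nx<a₀+1 = begin
        f x                                                   ≡⟨ f-step a₀ x a₀<N (a₀≤nx , nx<a₀+1) ⟩
        g a₀                                                  ≡⟨ ℚP.*-identityʳ (g a₀) ⟨
        g a₀ * 1ℚ
          ≡⟨ cong (g a₀ *_) (whenBoth-yes (fromℕ a₀ ℚP.≤? n * x) (n * x ℚP.<? fromℕ (suc a₀)) 1ℚ a₀≤nx nx<a₀+1) ⟨
        g a₀ * χ a₀ x
          ≡⟨ ℚΣ.∑-single N (λ a → g a * χ a x) a₀<N (λ a _ a≢a₀ → trans (cong (g a *_) (χ-elsewhere a a≢a₀)) (ℚP.*-zeroʳ (g a))) ⟨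
        ℚΣ.∑ N (λ a → g a * χ a x)                            ≡⟨ ℚP.+-identityʳ _ ⟨
        ℚΣ.∑ N (λ a → g a * χ a x) + 0ℚ
          ≡⟨ cong (ℚΣ.∑ N (λ a → g a * χ a x) +_) (trans (cong (f 1ℚ *_) (χ₁-outside x (inj₁ x<1))) (ℚP.*-zeroʳ (f 1ℚ))) ⟨
        ℚΣ.∑ N (λ a → g a * χ a x) + f 1ℚ * χ₁ x              ∎
        where
        open ≡-Reasoning
        χ-elsewhere : ∀ a → a ≢ a₀ → χ a x ≡ 0ℚ
        χ-elsewhere a a≢a₀ with ℕP.<-cmp a a₀
        ... | tri< a<a₀ _ _ = whenBoth-noʳ (fromℕ a ℚP.≤? n * x) (n * x ℚP.<? fromℕ (suc a)) 1ℚ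
          (λ nx<a+1 → <⇒≱ nx<a+1 (ℚP.≤-trans (fromℕ-mono-≤ a<a₀) a₀≤nx))
        ... | tri≈ _ a≡a₀ _ = ⊥-elim (a≢a₀ a≡a₀)
        ... | tri> _ _ a₀<a = whenBoth-noˡ (fromℕ a ℚP.≤? n * x) (n * x ℚP.<? fromℕ (suc a)) 1ℚ
          (<⇒≱ (ℚP.<-≤-trans nx<a₀+1 (fromℕ-mono-≤ a₀<a)))
      by-cases : Dec (1ℚ ≤ x) → f x ≡ ℚΣ.∑ N (λ a → g a * χ a x) + f 1ℚ * χ₁ x
      by-cases (yes 1≤x) = subst (λ y → f y ≡ ℚΣ.∑ N (λ a → g a * χ a y) + f 1ℚ * χ₁ y) (ℚP.≤-antisym 1≤x x≤1) at-one
      by-cases (no 1≰x)  = in-cell (ℚP.≰⇒> 1≰x)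

    private
      cellError : TaggedPartition 0ℚ 1ℚ → ℕ → ℚ
      cellError P a = riemannSum (χ a) P - (right a - left a)

      pointError : TaggedPartition 0ℚ 1ℚ → ℚ
      pointError P = riemannSum χ₁ P - (1ℚ - 1ℚ)

    riemannSum-decomposition : ∀ (P : TaggedPartition 0ℚ 1ℚ) →
      riemannSum f P - ℚΣ.∑ N (λ a → g a * w) ≡ ℚΣ.∑ N (λ a → g a * cellError P a) + f 1ℚ * pointError P
    riemannSum-decomposition P = begin
      riemannSum f P - I
        ≡⟨ cong (_- I) riemannSum-f ⟩
      ℚΣ.∑ N (λ a → g a * riemannSum (χ a) P) + f 1ℚ * riemannSum χ₁ P - I
        ≡⟨ solve 3 (λ A B C → A :+ B :- C := (A :- C) :+ B) refl (ℚΣ.∑ N (λ a → g a * riemannSum (χ a) P)) (f 1ℚ * riemannSum χ₁ P) I ⟩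
      (ℚΣ.∑ N (λ a → g a * riemannSum (χ a) P) - I) + f 1ℚ * riemannSum χ₁ P
        ≡⟨ cong₂ _+_ (sym (ℚΣ.∑-sub N (λ a → g a * riemannSum (χ a) P) (λ a → g a * w)))
                     (solve 2 (λ f r → f :* r := f :* (r :- (con 1ℚ :- con 1ℚ))) refl (f 1ℚ) (riemannSum χ₁ P)) ⟩
      ℚΣ.∑ N (λ a → g a * riemannSum (χ a) P - g a * w) + f 1ℚ * pointError P
        ≡⟨ cong (_+ f 1ℚ * pointError P) (ℚΣ.∑-cong N (λ a _ → trans
             (solve 3 (λ g r w → g :* r :- g :* w := g :* (r :- w)) refl (g a) (riemannSum (χ a) P) w)
             (cong (λ d → g a * (riemannSum (χ a) P - d)) (sym (right-left≡w a))))) ⟩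
      ℚΣ.∑ N (λ a → g a * cellError P a) + f 1ℚ * pointError P ∎
      where
      open ≡-Reasoning
      I = ℚΣ.∑ N (λ a → g a * w)
      riemannSum-f : riemannSum f P ≡ ℚΣ.∑ N (λ a → g a * riemannSum (χ a) P) + f 1ℚ * riemannSum χ₁ P
      riemannSum-f = trans (riemannSum-cong P f _ step-decomposition)
        (trans (riemannSum-+ P (λ x → ℚΣ.∑ N (λ a → g a * χ a x)) (λ x → f 1ℚ * χ₁ x))
          (cong₂ _+_ (trans (riemannSum-∑ P N (λ a x → g a * χ a x)) (ℚΣ.∑-cong N (λ a _ → riemannSum-*ˡ P (g a) (χ a))))
                     (riemannSum-*ˡ P (f 1ℚ) χ₁)))

    riemannSum-error : ∀ (P : TaggedPartition 0ℚ 1ℚ) →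
      ∣ riemannSum f P - ℚΣ.∑ N (λ a → g a * w) ∣ ≤ fromℕ (4 ℕ.* suc N) * mesh P
    riemannSum-error P = begin
      ∣ riemannSum f P - ℚΣ.∑ N (λ a → g a * w) ∣     ≡⟨ cong ∣_∣ (riemannSum-decomposition P) ⟩
      ∣ ℚΣ.∑ N (λ a → g a * E a) + f 1ℚ * E₁ ∣       ≤⟨ ℚP.∣p+q∣≤∣p∣+∣q∣ (ℚΣ.∑ N (λ a → g a * E a)) (f 1ℚ * E₁) ⟩
      ∣ ℚΣ.∑ N (λ a → g a * E a) ∣ + ∣ f 1ℚ * E₁ ∣    ≤⟨ ℚP.+-mono-≤ (ℚP.≤-trans (ℚΣ.∣∑∣≤∑∣∣ N (λ a → g a * E a))
                                                         (ℚΣ.∑-mono-≤ N (λ a a<N → ∣p*q∣≤r (∣g∣≤1 a a<N) (E≤W a a<N))))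
                                                       (∣p*q∣≤r (∣f∣≤1 1ℚ 0≤1 ℚP.≤-refl) E₁≤W) ⟩
      ℚΣ.∑ N (λ _ → W) + W                            ≡⟨ cong (_+ W) (ℚΣ.∑-const N W) ⟩
      n * W + W                                       ≡⟨ solve 2 (λ n m → n :* ((m :+ m) :+ (m :+ m)) :+ ((m :+ m) :+ (m :+ m))
                                                                  := (con (fromℕ 4) :* (con 1ℚ :+ n)) :* m) refl n m ⟩
      fromℕ 4 * (1ℚ + n) * m                          ≡⟨ cong (_* m) (trans (fromℕ-* 4 (suc N)) (cong (fromℕ 4 *_) (fromℕ-+ 1 N))) ⟨
      fromℕ (4 ℕ.* suc N) * m                         ∎
      where
      open ℚP.≤-Reasoning
      m = mesh P
      W = (m + m) + (m + m)
      E = cellError P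
      E₁ = pointError P
      E≤W : ∀ a → a ℕ.< N → ∣ E a ∣ ≤ W
      E≤W a a<N = IndicatorLike.riemannSum-error-01 (left a) (right a) (left≤right a) (χ a)
        (χ-bounds a) (χ-inside a) (χ-outside a) P (0≤left a) (right≤1 a a<N)
      E₁≤W : ∣ E₁ ∣ ≤ W
      E₁≤W = IndicatorLike.riemannSum-error-01 1ℚ 1ℚ ℚP.≤-refl χ₁ χ₁-bounds χ₁-inside χ₁-outside P 0≤1 ℚP.≤-refl

    integral : IsIntegral01 f (ℚΣ.∑ N (λ a → g a * w))
    integral ε 0<ε = δ , 0<δ , λ P mesh<δ → ℚP.≤-<-trans (riemannSum-error P)
      (ℚP.<-≤-trans (ℚP.*-monoʳ-<-pos M mesh<δ) (ℚP.≤-reflexive (fromℕ*[p*1/ℕ]≡p (4 ℕ.* suc N) ε)))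
      where
      M = fromℕ (4 ℕ.* suc N)
      instance
        M>0 : ℚ.Positive M
        M>0 = fromℕ-pos (4 ℕ.* suc N)
      δ = ε * 1/ℕ (4 ℕ.* suc N)
      0<δ : 0ℚ < δ
      0<δ = subst (_< δ) (ℚP.*-zeroˡ (1/ℕ (4 ℕ.* suc N))) (ℚP.*-monoˡ-<-pos (1/ℕ (4 ℕ.* suc N)) {{1/ℕ-pos (4 ℕ.* suc N)}} 0<ε)

module Discrepancy≡L1Norm (L m : ℕ) (m<2^L : m ℕ.< 2 ℕ.^ L) where

  open import Data.Nat using (_^_)
  open import Data.Integer as ℤ using (ℤ; +_)
  open import Data.Rational as ℚ using (ℚ; 0ℚ; 1ℚ; _+_; _*_; _-_; -_; _/_; _≤_; _<_; ∣_∣; _⊓_)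
  import Data.Rational.Properties as ℚP
  open import Data.Rational.Solver using (module +-*-Solver)
  open +-*-Solver using (solve; _:+_; _:*_; _:-_; _:=_; con)
  open import Data.List.Properties using (map-upTo)
  open import Data.Product using (proj₁; proj₂)
  open Embedding
  open BinaryDigits
  open Signs
  open DyadicCells
  open WalshSums
  open Excess
  open ℚInequalities
  open StepFunctions
  open ≡

  n = suc m
  N = 2 ^ L

  private
    n≤N : n ℕ.≤ N
    n≤N = m<2^L
    instance
      N≢0 : ℕ.NonZero N
      N≢0 = ℕP.m^n≢0 2 L
      n>0 : ℚ.Positive (fromℕ n)
      n>0 = fromℕ-pos n
      N>0 : ℚ.Positive (fromℕ N)
      N>0 = fromℕ-pos N
      n≥0 : ℚ.NonNegative (fromℕ n)
      n≥0 = ℚP.pos⇒nonNeg (fromℕ n)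
      N≥0 : ℚ.NonNegative (fromℕ N)
      N≥0 = ℚP.pos⇒nonNeg (fromℕ N)
    0≤1/n : 0ℚ ≤ 1/ℕ n
    0≤1/n = ℚP.<⇒≤ (ℚP.positive⁻¹ (1/ℕ n) {{1/ℕ-pos n}})

  ∥walshMean∥₁ : ℚ
  ∥walshMean∥₁ = fromℕ (walshL1 L n) * (1/ℕ n * 1/ℕ N)

  walshMean≡∑ : ∀ x → walshMean n x ≡ ℚΣ.∑ n (λ k → wal k x) * 1/ℕ n
  walshMean≡∑ x = cong (λ ws → foldr _+_ 0ℚ ws * 1/ℕ n) (map-upTo (λ k → wal k x) n)

  walshMean-inCell : ∀ a x → InCell N a x → walshMean n x ≡ fromℤ (walshSum L n a) * 1/ℕ n
  walshMean-inCell a x x∈a = trans (walshMean≡∑ x) (cong (_* 1/ℕ n) (begin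
    ℚΣ.∑ n (λ k → wal k x)                                  ≡⟨ ℚΣ.∑-cong n (λ k k<n → wal-inCell L a x k x∈a (ℕP.<-≤-trans k<n n≤N)) ⟩
    ℚΣ.∑ n (λ k → fromℤ (walshSign L k a))                  ≡⟨ ℚΣ.fromℤ-∑ n (λ k → walshSign L k a) ⟨
    fromℤ (walshSum L n a)                                  ∎))
    where open ≡-Reasoning

  ∣walshMean∣≤1 : ∀ x → ∣ walshMean n x ∣ ≤ 1ℚ
  ∣walshMean∣≤1 x = begin
    ∣ walshMean n x ∣                  ≡⟨ cong ∣_∣ (walshMean≡∑ x) ⟩
    ∣ ∑wal * 1/ℕ n ∣                   ≡⟨ trans (ℚP.∣p*q∣≡∣p∣*∣q∣ ∑wal (1/ℕ n)) (cong (∣ ∑wal ∣ *_) (ℚP.0≤p⇒∣p∣≡p 0≤1/n)) ⟩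
    ∣ ∑wal ∣ * 1/ℕ n                   ≤⟨ ℚP.*-monoʳ-≤-nonNeg (1/ℕ n) {{ℚ.nonNegative 0≤1/n}} (ℚΣ.∣∑∣≤∑∣∣ n (λ k → wal k x)) ⟩
    ℚΣ.∑ n (λ k → ∣ wal k x ∣) * 1/ℕ n  ≡⟨ cong (_* 1/ℕ n) (trans (ℚΣ.∑-cong n (λ k _ → ∣wal∣≡1 k)) (ℚΣ.∑-const n 1ℚ)) ⟩
    fromℕ n * 1ℚ * 1/ℕ n               ≡⟨ cong (_* 1/ℕ n) (ℚP.*-identityʳ (fromℕ n)) ⟩
    fromℕ n * 1/ℕ n                    ≡⟨ fromℕ*1/ℕ n ⟩
    1ℚ                                 ∎
    where
    open ℚP.≤-Reasoning
    ∑wal = ℚΣ.∑ n (λ k → wal k x)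
    ∣wal∣≡1 : ∀ k → ∣ wal k x ∣ ≡ 1ℚ
    ∣wal∣≡1 k = trans (cong ∣_∣ (parity≡sign e)) (cong fromℕ (∣sign∣≡1 e))
      where e = foldr ℕ._+_ 0 (map (λ j → digitℚ (suc j) x ℕ.* bitℕ j k) (upTo k))

  ∫∣walshMean∣ : IsIntegral01 (λ x → ∣ walshMean n x ∣) ∥walshMean∥₁
  ∫∣walshMean∣ = subst (IsIntegral01 (λ x → ∣ walshMean n x ∣)) ∑g/N≡∥walshMean∥₁
    (StepFunction.integral N (λ x → ∣ walshMean n x ∣) g
      (λ x _ _ → subst (_≤ 1ℚ) (sym (ℚP.∣∣p∣∣≡∣p∣ (walshMean n x))) (∣walshMean∣≤1 x))
      (λ a x _ x∈a → cong ∣_∣ (walshMean-inCell a x x∈a)))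
    where
    open ≡-Reasoning
    g : ℕ → ℚ
    g a = ∣ fromℤ (walshSum L n a) * 1/ℕ n ∣
    ∑g/N≡∥walshMean∥₁ : ℚΣ.∑ N (λ a → g a * 1/ℕ N) ≡ ∥walshMean∥₁
    ∑g/N≡∥walshMean∥₁ = begin
      ℚΣ.∑ N (λ a → g a * 1/ℕ N)
        ≡⟨ ℚΣ.∑-cong N (λ a _ → trans (cong (_* 1/ℕ N) (trans (ℚP.∣p*q∣≡∣p∣*∣q∣ (fromℤ (walshSum L n a)) (1/ℕ n))
             (cong (fromℕ ℤ.∣ walshSum L n a ∣ *_) (ℚP.0≤p⇒∣p∣≡p 0≤1/n))))
             (ℚP.*-assoc (fromℕ ℤ.∣ walshSum L n a ∣) (1/ℕ n) (1/ℕ N))) ⟩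
      ℚΣ.∑ N (λ a → fromℕ ℤ.∣ walshSum L n a ∣ * (1/ℕ n * 1/ℕ N))
        ≡⟨ ℚΣ.∑-*ʳ N (λ a → fromℕ ℤ.∣ walshSum L n a ∣) (1/ℕ n * 1/ℕ N) ⟨
      ℚΣ.∑ N (λ a → fromℕ ℤ.∣ walshSum L n a ∣) * (1/ℕ n * 1/ℕ N)
        ≡⟨ cong (_* (1/ℕ n * 1/ℕ N)) (ℚΣ.fromℕ-∑ N (λ a → ℤ.∣ walshSum L n a ∣)) ⟨
      ∥walshMean∥₁ ∎

  vdC-scaled : ∀ k → k ℕ.< N → fromℕ N * vdC k ≡ fromℕ (bitReverse L k)
  vdC-scaled k k<N = trans (cong (fromℕ N *_) (vdC≡bitReverse/2^L L k k<N)) (fromℕ*[p*1/ℕ]≡p N _)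

  countBelow-inCell : ∀ a t → fromℕ a < fromℕ N * t → fromℕ N * t ≤ fromℕ (suc a) → countBelow vdC n t ≡ count L n a
  countBelow-inCell a t a<Nt Nt≤a+1 = trans (length-filter-upTo (λ k → vdC k ℚP.<? t) n)
    (ℕΣ.∑-cong n (λ k k<n → indicator-cong (vdC k ℚP.<? t) (bitReverse L k ℕP.≤? a)
      (λ vdC<t → ℕP.≤-pred (fromℕ-cancel-< (ℚP.<-≤-trans (subst (_< fromℕ N * t) (vdC-scaled k (k<N k<n)) (ℚP.*-monoʳ-<-pos (fromℕ N) vdC<t)) Nt≤a+1)))
      (λ r≤a → ℚP.*-cancelˡ-<-nonNeg (fromℕ N) (ℚP.≤-<-trans (ℚP.≤-reflexive (vdC-scaled k (k<N k<n))) (ℚP.≤-<-trans (fromℕ-mono-≤ r≤a) a<Nt)))))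
    where
    k<N : ∀ {k} → k ℕ.< n → k ℕ.< N
    k<N k<n = ℕP.<-≤-trans k<n n≤N

  private
    K = fromℕ n * fromℕ N

    cancelK : ∀ {p q} → p * K ≡ q * K → p ≡ q
    cancelK {p} {q} pK≡qK = ℚP.≤-antisym (ℚP.*-cancelʳ-≤-pos K {{ℚP.pos*pos⇒pos (fromℕ n) (fromℕ N)}} (ℚP.≤-reflexive pK≡qK))
      (ℚP.*-cancelʳ-≤-pos K {{ℚP.pos*pos⇒pos (fromℕ n) (fromℕ N)}} (ℚP.≤-reflexive (sym pK≡qK)))

  signedDisc : ℕ → ℚ → ℚ
  signedDisc a t = + count L n a / n - t

  signedDisc*K : ∀ a t → signedDisc a t * K ≡ fromℤ (excess L n a) - fromℕ n * (fromℕ N * t - fromℕ a)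
  signedDisc*K a t = begin
    (+ c / n - t) * K
      ≡⟨ cong (λ q → (q - t) * K) (/≡fromℤ*1/ℕ (+ c) n) ⟩
    (fromℕ c * 1/ℕ n - t) * (fromℕ n * fromℕ N)
      ≡⟨ solve 5 (λ C i T n N → (C :* i :- T) :* (n :* N) := (n :* i) :* (N :* C) :- n :* (N :* T)) refl
           (fromℕ c) (1/ℕ n) t (fromℕ n) (fromℕ N) ⟩
    fromℕ n * 1/ℕ n * (fromℕ N * fromℕ c) - fromℕ n * (fromℕ N * t)
      ≡⟨ cong (λ u → u * (fromℕ N * fromℕ c) - fromℕ n * (fromℕ N * t)) (fromℕ*1/ℕ n) ⟩
    1ℚ * (fromℕ N * fromℕ c) - fromℕ n * (fromℕ N * t)
      ≡⟨ solve 5 (λ N C n T A → con 1ℚ :* (N :* C) :- n :* (N :* T) := (N :* C :- n :* A) :- n :* (N :* T :- A)) refl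
           (fromℕ N) (fromℕ c) (fromℕ n) t (fromℕ a) ⟩
    (fromℕ N * fromℕ c - fromℕ n * fromℕ a) - fromℕ n * (fromℕ N * t - fromℕ a)
      ≡⟨ cong (_- fromℕ n * (fromℕ N * t - fromℕ a)) fromℤ-excess ⟨
    fromℤ (excess L n a) - fromℕ n * (fromℕ N * t - fromℕ a) ∎
    where
    open ≡-Reasoning
    c = count L n a
    fromℤ-excess : fromℤ (excess L n a) ≡ fromℕ N * fromℕ c - fromℕ n * fromℕ a
    fromℤ-excess = trans (fromℤ-minus (+ N ℤ.* + c) (+ n ℤ.* + a)) (cong₂ _-_ (fromℤ-* (+ N) (+ c)) (fromℤ-* (+ n) (+ a)))

  ∥walshMean∥₁*K : ∥walshMean∥₁ * K ≡ fromℕ (walshL1 L n)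
  ∥walshMean∥₁*K = begin
    fromℕ U * (1/ℕ n * 1/ℕ N) * (fromℕ n * fromℕ N)
      ≡⟨ solve 5 (λ U i j n N → U :* (i :* j) :* (n :* N) := U :* ((n :* i) :* (N :* j))) refl (fromℕ U) (1/ℕ n) (1/ℕ N) (fromℕ n) (fromℕ N) ⟩
    fromℕ U * (fromℕ n * 1/ℕ n * (fromℕ N * 1/ℕ N))         ≡⟨ cong₂ (λ p q → fromℕ U * (p * q)) (fromℕ*1/ℕ n) (fromℕ*1/ℕ N) ⟩
    fromℕ U * 1ℚ                                           ≡⟨ ℚP.*-identityʳ (fromℕ U) ⟩
    fromℕ U                                                ∎
    where
    open ≡-Reasoning
    U = walshL1 L n

  private
    offset-bounds : ∀ a X → fromℕ a < X → X ≤ fromℕ (suc a) → 0ℚ < X - fromℕ a × X - fromℕ a ≤ 1ℚ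
    offset-bounds a X a<X X≤a+1 = p<q⇒0<q-p a<X ,
      subst (X - fromℕ a ≤_) [1+a]-a≡1 (ℚP.+-monoˡ-≤ (- fromℕ a) X≤a+1)
      where
      [1+a]-a≡1 : fromℕ (suc a) - fromℕ a ≡ 1ℚ
      [1+a]-a≡1 = trans (cong (_- fromℕ a) (fromℕ-+ 1 a)) (solve 1 (λ A → con 1ℚ :+ A :- A := con 1ℚ) refl (fromℕ a))
        where open +-*-Solver using (con)

  signedDisc-inCell : ∀ a t → a ℕ.< N → fromℕ a < fromℕ N * t → fromℕ N * t ≤ fromℕ (suc a) →
    0ℚ ≤ signedDisc a t × signedDisc a t < ∥walshMean∥₁
  signedDisc-inCell a t a<N a<Nt Nt≤a+1 = 0≤D , D<∥walshMean∥₁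
    where
    open ℚP.≤-Reasoning
    instance
      K>0 : ℚ.Positive K
      K>0 = ℚP.pos*pos⇒pos (fromℕ n) (fromℕ N)
      K≥0 : ℚ.NonNegative K
      K≥0 = ℚP.pos⇒nonNeg K
    θ = fromℕ N * t - fromℕ a
    ex = fromℤ (excess L n a)
    θ-bounds : 0ℚ < θ × θ ≤ 1ℚ
    θ-bounds = offset-bounds a (fromℕ N * t) a<Nt Nt≤a+1
    0≤D : 0ℚ ≤ signedDisc a t
    0≤D = ℚP.*-cancelʳ-≤-pos K (begin
      0ℚ * K                 ≡⟨ ℚP.*-zeroˡ K ⟩
      0ℚ                     ≤⟨ p≤q⇒0≤q-p (begin
        fromℕ n * θ              ≤⟨ ℚP.*-monoˡ-≤-nonNeg (fromℕ n) (proj₂ θ-bounds) ⟩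
        fromℕ n * 1ℚ             ≡⟨ ℚP.*-identityʳ (fromℕ n) ⟩
        fromℕ n                  ≤⟨ fromℤ-mono-≤ (excess-lower L n a n≤N a<N) ⟩
        ex                       ∎) ⟩
      ex - fromℕ n * θ       ≡⟨ signedDisc*K a t ⟨
      signedDisc a t * K     ∎)
    D<∥walshMean∥₁ : signedDisc a t < ∥walshMean∥₁
    D<∥walshMean∥₁ = ℚP.*-cancelʳ-<-nonNeg K (begin-strict
      signedDisc a t * K     ≡⟨ signedDisc*K a t ⟩
      ex - fromℕ n * θ       <⟨ p-q<p (subst (_< fromℕ n * θ) (ℚP.*-zeroʳ (fromℕ n)) (ℚP.*-monoʳ-<-pos (fromℕ n) (proj₁ θ-bounds))) ⟩
      ex                     ≤⟨ fromℤ-mono-≤ (excess-upper L n a n≤N a<N) ⟩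
      fromℕ (walshL1 L n)    ≡⟨ ∥walshMean∥₁*K ⟨
      ∥walshMean∥₁ * K       ∎)

  localDisc-inCell : ∀ a t → a ℕ.< N → fromℕ a < fromℕ N * t → fromℕ N * t ≤ fromℕ (suc a) →
    localDisc vdC n t ≡ signedDisc a t
  localDisc-inCell a t a<N a<Nt Nt≤a+1 = trans (cong (λ c → ∣ + c / n - t ∣) (countBelow-inCell a t a<Nt Nt≤a+1))
    (ℚP.0≤p⇒∣p∣≡p (proj₁ (signedDisc-inCell a t a<N a<Nt Nt≤a+1)))

  0≤∥walshMean∥₁ : 0ℚ ≤ ∥walshMean∥₁
  0≤∥walshMean∥₁ = subst (_≤ ∥walshMean∥₁) (ℚP.*-zeroˡ (1/ℕ n * 1/ℕ N))
    (ℚP.*-monoʳ-≤-nonNeg (1/ℕ n * 1/ℕ N) {{ℚP.pos⇒nonNeg (1/ℕ n * 1/ℕ N) {{ℚP.pos*pos⇒pos (1/ℕ n) {{1/ℕ-pos n}} (1/ℕ N) {{1/ℕ-pos N}}}}}} (fromℕ-mono-≤ z≤n))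

  localDisc≤∥walshMean∥₁ : ∀ t → 0ℚ ≤ t → t ≤ 1ℚ → localDisc vdC n t ≤ ∥walshMean∥₁
  localDisc≤∥walshMean∥₁ t 0≤t t≤1 = by-cases (t ℚP.≤? 0ℚ)
    where
    0≤vdC : ∀ k → k ℕ.< N → 0ℚ ≤ vdC k
    0≤vdC k k<N = ℚP.*-cancelˡ-≤-pos (fromℕ N) (subst₂ _≤_ (sym (ℚP.*-zeroʳ (fromℕ N))) (sym (vdC-scaled k k<N)) (fromℕ-mono-≤ z≤n))
    countBelow-0 : countBelow vdC n 0ℚ ≡ 0
    countBelow-0 = trans (length-filter-upTo (λ k → vdC k ℚP.<? 0ℚ) n)
      (ℕΣ.∑-ε n (λ k k<n → indicator-false (vdC k ℚP.<? 0ℚ) (λ vdC<0 → <⇒≱ vdC<0 (0≤vdC k (ℕP.<-≤-trans k<n n≤N)))))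
    localDisc-at-0 : localDisc vdC n 0ℚ ≡ 0ℚ
    localDisc-at-0 = begin
      ∣ + countBelow vdC n 0ℚ / n - 0ℚ ∣   ≡⟨ cong (λ c → ∣ + c / n - 0ℚ ∣) countBelow-0 ⟩
      ∣ + 0 / n - 0ℚ ∣                     ≡⟨ cong (λ q → ∣ q - 0ℚ ∣) (ℚP.0/n≡0 n) ⟩
      ∣ 0ℚ - 0ℚ ∣                          ≡⟨⟩
      0ℚ                                   ∎
      where open ≡-Reasoning
    in-cell : (Σ ℕ λ a → a ℕ.< N × fromℕ a < fromℕ N * t × fromℕ N * t ≤ fromℕ (suc a)) → localDisc vdC n t ≤ ∥walshMean∥₁
    in-cell (a , a<N , a<Nt , Nt≤a+1) = ℚP.≤-trans (ℚP.≤-reflexive (localDisc-inCell a t a<N a<Nt Nt≤a+1))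
      (ℚP.<⇒≤ (proj₂ (signedDisc-inCell a t a<N a<Nt Nt≤a+1)))
    by-cases : Dec (t ≤ 0ℚ) → localDisc vdC n t ≤ ∥walshMean∥₁
    by-cases (yes t≤0) = subst (λ s → localDisc vdC n s ≤ ∥walshMean∥₁) (ℚP.≤-antisym 0≤t t≤0)
      (ℚP.≤-trans (ℚP.≤-reflexive localDisc-at-0) 0≤∥walshMean∥₁)
    by-cases (no t≰0) = in-cell (locate-<≤ N (fromℕ N * t)
      (subst (_< fromℕ N * t) (ℚP.*-zeroʳ (fromℕ N)) (ℚP.*-monoʳ-<-pos (fromℕ N) (ℚP.≰⇒> t≰0)))
      (subst (fromℕ N * t ≤_) (ℚP.*-identityʳ (fromℕ N)) (ℚP.*-monoˡ-≤-nonNeg (fromℕ N) t≤1)))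

  localDisc-near-cell : ∀ a θ → a ℕ.< N → excess L n a ≡ + walshL1 L n → 0ℚ < θ → θ ≤ 1ℚ →
    localDisc vdC n ((fromℕ a + θ) * 1/ℕ N) ≡ ∥walshMean∥₁ - θ * 1/ℕ N
  localDisc-near-cell a θ a<N ex≡U 0<θ θ≤1 = trans (localDisc-inCell a t a<N a<Nt Nt≤a+1) (cancelK (begin
    signedDisc a t * K                                     ≡⟨ signedDisc*K a t ⟩
    fromℤ (excess L n a) - fromℕ n * (fromℕ N * t - fromℕ a) ≡⟨ cong₂ (λ e s → e - fromℕ n * (s - fromℕ a)) (cong fromℤ ex≡U) Nt≡a+θ ⟩
    fromℕ U - fromℕ n * (fromℕ a + θ - fromℕ a)            ≡⟨ solve 4 (λ U n A θ → U :- n :* (A :+ θ :- A) := U :- n :* θ) refl (fromℕ U) (fromℕ n) (fromℕ a) θ ⟩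
    fromℕ U - fromℕ n * θ                                  ≡⟨ cong (λ s → fromℕ U - s) (ℚP.*-identityʳ (fromℕ n * θ)) ⟨
    fromℕ U - fromℕ n * θ * 1ℚ                             ≡⟨ cong₂ (λ u w → u - fromℕ n * θ * w) ∥walshMean∥₁*K (fromℕ*1/ℕ N) ⟨
    ∥walshMean∥₁ * K - fromℕ n * θ * (fromℕ N * 1/ℕ N)     ≡⟨ solve 5 (λ v θ w n N → v :* (n :* N) :- n :* θ :* (N :* w) := (v :- θ :* w) :* (n :* N)) refl ∥walshMean∥₁ θ (1/ℕ N) (fromℕ n) (fromℕ N) ⟩
    (∥walshMean∥₁ - θ * 1/ℕ N) * K                         ∎))
    where
    open ≡-Reasoning
    U = walshL1 L n
    t = (fromℕ a + θ) * 1/ℕ N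
    Nt≡a+θ : fromℕ N * t ≡ fromℕ a + θ
    Nt≡a+θ = fromℕ*[p*1/ℕ]≡p N (fromℕ a + θ)
    a<Nt : fromℕ a < fromℕ N * t
    a<Nt = subst₂ _<_ (ℚP.+-identityʳ (fromℕ a)) (sym Nt≡a+θ) (ℚP.+-monoʳ-< (fromℕ a) 0<θ)
    Nt≤a+1 : fromℕ N * t ≤ fromℕ (suc a)
    Nt≤a+1 = subst₂ _≤_ (sym Nt≡a+θ) (trans (ℚP.+-comm (fromℕ a) 1ℚ) (sym (fromℕ-+ 1 a))) (ℚP.+-monoʳ-≤ (fromℕ a) θ≤1)

  localDisc-approaches : ∀ ε → 0ℚ < ε → Σ ℚ λ t → 0ℚ ≤ t × t ≤ 1ℚ × ∥walshMean∥₁ - ε < localDisc vdC n t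
  localDisc-approaches ε 0<ε = near (excess-attained L m m<2^L)
    (ℚP.<-dense (0<p⊓q (subst (_< ε * fromℕ N) (ℚP.*-zeroˡ (fromℕ N)) (ℚP.*-monoˡ-<-pos (fromℕ N) 0<ε)) (ℚP.positive⁻¹ 1ℚ)))
    where
    w = 1/ℕ N
    instance
      w≥0 : ℚ.NonNegative w
      w≥0 = ℚP.pos⇒nonNeg w {{1/ℕ-pos N}}
    μ = ε * fromℕ N ⊓ 1ℚ
    near : (Σ ℕ λ a → a ℕ.< N × excess L m a ≡ + walshL1 L m × excess L n a ≡ + walshL1 L n) →
           (Σ ℚ λ θ → 0ℚ < θ × θ < μ) → Σ ℚ λ t → 0ℚ ≤ t × t ≤ 1ℚ × ∥walshMean∥₁ - ε < localDisc vdC n t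
    near (a , a<N , _ , ex≡U) (θ , 0<θ , θ<μ) = t , 0≤t , t≤1 , v-ε<localDisc
      where
      θ≤1 : θ ≤ 1ℚ
      θ≤1 = ℚP.≤-trans (ℚP.<⇒≤ θ<μ) (ℚP.p⊓q≤q (ε * fromℕ N) 1ℚ)
      t = (fromℕ a + θ) * w
      0≤t : 0ℚ ≤ t
      0≤t = subst (_≤ t) (ℚP.*-zeroˡ w) (ℚP.*-monoʳ-≤-nonNeg w
        (ℚP.≤-trans (fromℕ-mono-≤ {0} {a} z≤n) (subst (_≤ fromℕ a + θ) (ℚP.+-identityʳ (fromℕ a)) (ℚP.+-monoʳ-≤ (fromℕ a) (ℚP.<⇒≤ 0<θ)))))
      t≤1 : t ≤ 1ℚ
      t≤1 = subst (t ≤_) (fromℕ*1/ℕ N) (ℚP.*-monoʳ-≤-nonNeg w (ℚP.≤-trans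
        (subst (fromℕ a + θ ≤_) (trans (ℚP.+-comm (fromℕ a) 1ℚ) (sym (fromℕ-+ 1 a))) (ℚP.+-monoʳ-≤ (fromℕ a) θ≤1))
        (fromℕ-mono-≤ a<N)))
      θw<ε : θ * w < ε
      θw<ε = subst (θ * w <_) (trans (ℚP.*-assoc ε (fromℕ N) w) (trans (cong (ε *_) (fromℕ*1/ℕ N)) (ℚP.*-identityʳ ε)))
        (ℚP.*-monoˡ-<-pos w {{1/ℕ-pos N}} (ℚP.<-≤-trans θ<μ (ℚP.p⊓q≤p (ε * fromℕ N) 1ℚ)))
      v-ε<localDisc : ∥walshMean∥₁ - ε < localDisc vdC n t
      v-ε<localDisc = subst (∥walshMean∥₁ - ε <_) (sym (localDisc-near-cell a θ a<N ex≡U 0<θ θ≤1))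
        (ℚP.+-monoʳ-< ∥walshMean∥₁ (ℚP.neg-antimono-< θw<ε))

mainTheorem2 : (m : ℕ) → Σ ℚ (λ v →
    IsSupOn01 (localDisc vdC (suc m)) v × IsIntegral01 (λ x → ∣ walshMean (suc m) x ∣) v)
mainTheorem2 m = ∥walshMean∥₁ , (localDisc≤∥walshMean∥₁ , localDisc-approaches) , ∫∣walshMean∣
  where open Discrepancy≡L1Norm m m (BinaryDigits.n<2^n m)
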